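{- The Hopf algebra $NCQSym$ is cofree: its graded dual $NCQSym^\ast$ is a free associative algebra, freely generated by $\{\mathbf{V}_\Phi : \Phi\models[n],\ n\ge0,\ \Phi\text{ atomic}\}$.
   Context: A set composition $\Phi\models[n]$ is a sequence $(\Phi_1,\dots,\Phi_\ell)$ of nonempty pairwise disjoint subsets of $[n]$ with union $[n]$; $\ell(\Phi)=\ell$, $\alpha(\Phi)=(|\Phi_1|,\dots,|\Phi_\ell|)$. $\Phi|\Psi=(\Phi_1,\dots,\Phi_{\ell(\Phi)},\Psi_1+n,\dots,\Psi_{\ell(\Psi)}+n)$ for $\Phi\models[n]$. $\Phi$ is atomic if $n\ge1$ and $\Phi\ne\Psi|\Gamma$ for nonempty $\Psi,\Gamma$; $\Phi$ factors uniquely as $\Phi^{(1)}|\cdots|\Phi^{(d)}$ with atomic factors, $\Phi^!=(\Phi^{(1)},\dots,\Phi^{(d)})$. $st$ standardizes entries to $1,2,\dots$ preserving relative order; $\Phi\!\uparrow_S$ relabels entries via the order-preserving bijection $[n]\to S$; $\cdot$ is concatenation. $NCQSym$ has basis $\mathbf{M}_\Phi$ with product $\mathbf{M}_\Phi\mathbf{M}_\Psi=\sum_{\Gamma:\ (([n])|([k]))\wedge\Gamma=\Phi|\Psi}\mathbf{M}_\Gamma$ (where $\Theta\wedge\Gamma$ lists the nonempty $\Theta_i\cap\Gamma_j$ in lexicographic order of $(i,j)$ and $([n])|([k])=([n],\{n+1,\dots,n+k\})$) and coproduct $\Delta(\mathbf{M}_\Phi)=\sum_{i=0}^{\ell(\Phi)}\mathbf{M}_{st(\Phi_1,\dots,\Phi_i)}\otimes\mathbf{M}_{st(\Phi_{i+1},\dots,\Phi_{\ell(\Phi)})}$.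 Its graded dual $NCQSym^\ast$ has basis $\mathbf{W}_\Phi$ dual to $\mathbf{M}_\Phi$, with product $\mathbf{W}_\Phi\mathbf{W}_\Psi=\sum_{S\in\binom{[n+m]}{n}}\mathbf{W}_{\Phi\uparrow_S\cdot\Psi\uparrow_{[n+m]\setminus S}}$ for $\Phi\models[n]$, $\Psi\models[m]$. $\Phi\le_\#\Psi$ iff $\alpha(\Phi)=\alpha(\Psi)$ and $\Phi^{(i)}=st(\Psi_{\ell_{i-1}+1},\dots,\Psi_{\ell_i})$ for all $i$, where $\ell_0=0$, $\ell_i=\ell(\Phi^{(1)})+\cdots+\ell(\Phi^{(i)})$. $\mathbf{V}_\Phi=\sum_{\Phi'\ge_\#\Phi}\mathbf{W}_{\Phi'}$. -}

module Defs where

open import Data.Bool using (Bool; true; false; if_then_else_; _∧_)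
open import Data.Nat as ℕ using (ℕ; zero; suc; _⊔_; _<?_; _≡ᵇ_; _≤_)
open import Data.List using (List; []; _∷_; _++_; map; concat; concatMap; filter; length; take; drop; upTo; foldr; sum)
open import Data.List.Properties using (≡-dec)
open import Data.List.Relation.Unary.All using (All)
open import Data.List.Relation.Unary.Linked using (Linked)
open import Data.List.Membership.DecPropositional ℕ._≟_ using (_∉?_)
open import Data.List.Relation.Binary.Permutation.Propositional using (_↭_)
open import Data.Product using (Σ; ∃; _×_; _,_; proj₁; proj₂)
open import Data.Rational using (ℚ; 0ℚ; 1ℚ) renaming (_+_ to _+ℚ_; _*_ to _*ℚ_)
open import Relation.Binary.PropositionalEquality using (_≡_; _≢_)
open import Relation.Nullary using (¬_; Dec)
open import Relation.Nullary.Decidable using (⌊_⌋)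
open import Relation.Nullary.Decidable using (T?)

-- A set composition is represented by its list of blocks; each block (a
-- finite subset of ℕ) is represented canonically as a strictly increasing
-- list of its elements.  Entries are 1-based as in the paper.

Block : Set
Block = List ℕ

SC : Set
SC = List Block

range : ℕ → List ℕ
range n = map suc (upTo n)

-- Φ ⊨ [n]: nonempty blocks, each a (canonically listed) set, pairwise
-- disjoint with union [n]  (disjointness + union = the concatenation of the
-- blocks is a permutation of 1,…,n).
NonEmpty : Block → Set
NonEmpty B = B ≢ []

IsSetComp : ℕ → SC → Set
IsSetComp n Φ = All NonEmpty Φ × All (Linked ℕ._<_) Φ × (concat Φ ↭ range n)

size : SC → ℕ
size Φ = length (concat Φ)

shift : ℕ → SC → SC
shift n Ψ = map (map (ℕ._+ n)) Ψ

bar : ℕ → SC → SC → SC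
bar n Φ Ψ = Φ ++ shift n Ψ

Atomic : SC → Set
Atomic Φ = Σ ℕ λ n → IsSetComp n Φ × 1 ≤ n ×
  ¬ (Σ ℕ λ m → Σ ℕ λ k → Σ SC λ Ψ → Σ SC λ Γ →
       IsSetComp m Ψ × IsSetComp k Γ × Ψ ≢ [] × Γ ≢ [] × Φ ≡ bar m Ψ Γ)

_=SC_ : SC → SC → Bool
Φ =SC Ψ = ⌊ ≡-dec (≡-dec ℕ._≟_) Φ Ψ ⌋

_=L_ : List ℕ → List ℕ → Bool
a =L b = ⌊ ≡-dec ℕ._≟_ a b ⌋

st : SC → SC
st Φ = map (map rank) Φ
  where
  rank : ℕ → ℕ
  rank x = suc (length (filter (λ y → y <? x) (concat Φ)))

maxL : List ℕ → ℕ
maxL = foldr _⊔_ 0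

-- Atomic factorization Φ! = (Φ⁽¹⁾,…,Φ⁽ᵈ⁾): a prefix of blocks whose union is
-- [k] (i.e. maximum = number of entries) is cut greedily at the shortest
-- such prefix; the factors are the standardized chunks.
factorsGo : SC → ℕ → ℕ → SC → List SC
factorsGo acc cnt mx [] with acc
... | [] = []
... | _ ∷ _ = st acc ∷ []
factorsGo acc cnt mx (B ∷ Bs) =
  let cnt′ = cnt ℕ.+ length B
      mx′  = mx ⊔ maxL B
  in if mx′ ≡ᵇ cnt′
     then st (acc ++ (B ∷ [])) ∷ factorsGo [] cnt′ mx′ Bs
     else factorsGo (acc ++ (B ∷ [])) cnt′ mx′ Bs

factors : SC → List SC
factors Φ = factorsGo [] 0 0 Φ

-- Φ ≤# Ψ  (Boolean-valued): α(Φ) = α(Ψ) and Φ⁽ⁱ⁾ = st(Ψ_{ℓ_{i-1}+1},…,Ψ_{ℓ_i})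
checkFactors : List SC → SC → Bool
checkFactors [] [] = true
checkFactors [] (_ ∷ _) = false
checkFactors (F ∷ Fs) Ψ =
  (st (take (length F) Ψ) =SC F) ∧ checkFactors Fs (drop (length F) Ψ)

_≤#_ : SC → SC → Bool
Φ ≤# Ψ = (map length Φ =L map length Ψ) ∧ checkFactors (factors Φ) Ψ

addToBlocks : ℕ → SC → List SC
addToBlocks x [] = []
addToBlocks x (B ∷ Bs) = ((B ++ (x ∷ [])) ∷ Bs) ∷ map (B ∷_) (addToBlocks x Bs)

insertSingleton : ℕ → SC → List SC
insertSingleton x [] = ((x ∷ []) ∷ []) ∷ []
insertSingleton x (B ∷ Bs) = ((x ∷ []) ∷ B ∷ Bs) ∷ map (B ∷_) (insertSingleton x Bs)

setComps : ℕ → List SC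
setComps zero = [] ∷ []
setComps (suc n) =
  concatMap (λ Φ → addToBlocks (suc n) Φ ++ insertSingleton (suc n) Φ) (setComps n)

-- NCQSym* : formal ℚ-linear combinations of the basis W_Φ

Lin : Set
Lin = List (ℚ × SC)

coeff : Lin → SC → ℚ
coeff x Φ = foldr _+ℚ_ 0ℚ (map proj₁ (filter (λ p → ≡-dec (≡-dec ℕ._≟_) (proj₂ p) Φ) x))

_≈_ : Lin → Lin → Set
x ≈ y = ∀ Φ → coeff x Φ ≡ coeff y Φ

zeroL : Lin
zeroL = []

W : SC → Lin
W Φ = (1ℚ , Φ) ∷ []

scale : ℚ → Lin → Lin
scale a x = map (λ p → (a *ℚ proj₁ p , proj₂ p)) x

subsets : ℕ → List ℕ → List (List ℕ)
subsets zero _ = [] ∷ []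
subsets (suc k) [] = []
subsets (suc k) (x ∷ xs) = map (x ∷_) (subsets k xs) ++ subsets (suc k) xs

nth : List ℕ → ℕ → ℕ
nth [] _ = 0
nth (x ∷ xs) zero = x
nth (x ∷ xs) (suc i) = nth xs i

-- Φ↑S : relabel j ↦ j-th smallest element of S (S listed increasingly)
up : SC → List ℕ → SC
up Φ S = map (map (λ j → nth S (j ℕ.∸ 1))) Φ

mulW : SC → SC → Lin
mulW Φ Ψ =
  let n = size Φ
      m = size Ψ
      N = range (n ℕ.+ m)
  in map (λ S → (1ℚ , up Φ S ++ up Ψ (filter (λ j → j ∉? S) N)))
         (subsets n N)

_·_ : Lin → Lin → Lin
x · y = concatMap (λ p → concatMap (λ q →
          scale (proj₁ p *ℚ proj₁ q) (mulW (proj₂ p) (proj₂ q))) y) x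

V : SC → Lin
V Φ = map (λ Ψ → (1ℚ , Ψ)) (filter (λ Ψ → T? (Φ ≤# Ψ)) (setComps (size Φ)))

prodV : List SC → Lin
prodV [] = W []
prodV (Φ ∷ w) = V Φ · prodV w

Word : List SC → Set
Word w = All Atomic w

comb : List (ℚ × List SC) → Lin
comb c = concatMap (λ p → scale (proj₁ p) (prodV (proj₂ p))) c

wcoeff : List (ℚ × List SC) → List SC → ℚ
wcoeff c u = foldr _+ℚ_ 0ℚ
  (map proj₁ (filter (λ p → ≡-dec (≡-dec (≡-dec ℕ._≟_)) (proj₂ p) u) c))

module Submission where

-- Write bars u = A₁|⋯|A_k for a word u = A₁⋯A_k of atomic set compositions. Cutting a set
-- composition at its first cut (a position where all earlier entries are smaller than all later
-- ones) shows that every set composition is bars u for a unique atomic word u. Each W-term of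
-- V_u = V_{A₁}⋯V_{A_k} has coefficient 1 and is a set composition Ψ whose consecutive chunks
-- standardize to A₁, …, A_k; as the letters are atomic, every cut of Ψ is a chunk boundary, so Ψ
-- has at most k cuts, with equality only for Ψ = bars u, which does occur. Thus V_u is a positive
-- multiple of W_{bars u} plus terms with fewer cuts, and induction on the number of cuts shows that
-- the V_u span. In a vanishing combination of the V_u, the coefficient of W_{bars u} involves only
-- the weight of u and of words with more letters and the same number of blocks, so induction on
-- (number of blocks − number of letters) shows that all weights vanish.

open import Defs
open import Data.Bool using (true; false; if_then_else_; T)
open import Data.Bool.Properties using (T-∧)
open import Data.Unit using (tt)
open import Data.Empty using (⊥; ⊥-elim)
open import Data.Nat using (ℕ; zero; suc; _+_; _∸_; _⊔_; _≤_; _<_; z≤n; s≤s; _<?_; _≤?_; _≡ᵇ_; _≟_)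
import Data.Nat.Properties as ℕ
open import Data.List using (List; []; _∷_; _++_; map; concat; concatMap; filter; length; take; drop; foldr; applyUpTo)
import Data.List.Properties as List
open import Data.List.Relation.Unary.All using (All; []; _∷_)
import Data.List.Relation.Unary.All as All
import Data.List.Relation.Unary.All.Properties as All
open import Data.List.Relation.Unary.Any using (Any; here; there; any?)
open import Data.List.Relation.Unary.AllPairs using (AllPairs; []; _∷_)
import Data.List.Relation.Unary.AllPairs as AllPairs
import Data.List.Relation.Unary.AllPairs.Properties as AllPairs
open import Data.List.Membership.DecPropositional _≟_ using (_∉?_)
open import Data.List.Relation.Unary.Linked using (Linked; []; [-]; _∷_)
open import Data.List.Relation.Unary.Unique.Propositional using (Unique)
open import Data.List.Relation.Unary.Unique.Propositional.Properties using (Unique[x∷xs]⇒x∉xs) renaming (++⁺ to Unique-++⁺)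
open import Data.List.Membership.Propositional using (_∈_; _∉_; find; lose)
import Data.List.Membership.Propositional.Properties as ∈
open import Data.List.Relation.Binary.Permutation.Propositional using (_↭_; ↭-refl; ↭-sym; ↭-trans; prep; ↭⇒↭ₛ)
import Data.List.Relation.Binary.Permutation.Propositional.Properties as ↭
import Data.List.Relation.Binary.Permutation.Setoid.Properties as ↭ₛ
open import Data.Product using (Σ; ∃; _×_; _,_; proj₁; proj₂)
open import Data.Sum using (_⊎_; inj₁; inj₂; [_,_]′)
open import Relation.Binary.PropositionalEquality using (_≡_; _≢_; refl; sym; trans; cong; cong₂; subst; subst₂; setoid; module ≡-Reasoning)
open import Relation.Binary.Definitions using (tri<; tri≈; tri>)
open import Relation.Nullary using (¬_; Dec; yes; no; does)
open import Relation.Nullary.Decidable using (T?; toWitness; fromWitness; ¬?; map′; decidable-stable)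
open import Function using (_∘_; id; _⇔_; mk⇔; Equivalence)
open import Data.Rational using (ℚ; 0ℚ; 1ℚ)
import Data.Rational as ℚ
import Data.Rational.Properties as ℚ

interval : ℕ → ℕ → List ℕ
interval a zero = []
interval a (suc n) = a ∷ interval (suc a) n

range≡interval : ∀ n → range n ≡ interval 1 n
range≡interval n = go id 1 n λ _ → refl
  where
  go : ∀ (f : ℕ → ℕ) a n → (∀ i → suc (f i) ≡ a + i) → map suc (applyUpTo f n) ≡ interval a n
  go f a zero h = refl
  go f a (suc n) h = cong₂ _∷_ (trans (h 0) (ℕ.+-identityʳ a))
    (go (f ∘ suc) (suc a) n λ i → trans (h (suc i)) (ℕ.+-suc a i))

∈-interval⁻ : ∀ {x} a n → x ∈ interval a n → a ≤ x × x < a + n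
∈-interval⁻ a (suc n) (here refl) = ℕ.≤-refl , ℕ.m<m+n a (s≤s z≤n)
∈-interval⁻ {x} a (suc n) (there p) with ∈-interval⁻ (suc a) n p
... | a<x , x<1+a+n = ℕ.<⇒≤ a<x , subst (x <_) (sym (ℕ.+-suc a n)) x<1+a+n

∈-interval⁺ : ∀ {x} a n → a ≤ x → x < a + n → x ∈ interval a n
∈-interval⁺ {x} a zero a≤x x<a+0 = ⊥-elim (ℕ.<-irrefl refl (ℕ.≤-<-trans a≤x (subst (x <_) (ℕ.+-identityʳ a) x<a+0)))
∈-interval⁺ {x} a (suc n) a≤x x<a+n with a ≟ x
... | yes refl = here refl
... | no a≢x = there (∈-interval⁺ (suc a) n (ℕ.≤∧≢⇒< a≤x a≢x) (subst (x <_) (ℕ.+-suc a n) x<a+n))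

length-interval : ∀ a n → length (interval a n) ≡ n
length-interval a zero = refl
length-interval a (suc n) = cong suc (length-interval (suc a) n)

interval-++ : ∀ a n m → interval a (n + m) ≡ interval a n ++ interval (a + n) m
interval-++ a zero m = cong (λ b → interval b m) (sym (ℕ.+-identityʳ a))
interval-++ a (suc n) m = cong (a ∷_)
  (trans (interval-++ (suc a) n m) (cong (λ b → interval (suc a) n ++ interval b m) (sym (ℕ.+-suc a n))))

interval-increasing : ∀ a n → AllPairs _<_ (interval a n)
interval-increasing a zero = []
interval-increasing a (suc n) =
  All.tabulate (λ p → proj₁ (∈-interval⁻ (suc a) n p)) ∷ interval-increasing (suc a) n

increasing⇒unique : ∀ {xs} → AllPairs _<_ xs → Unique xs
increasing⇒unique = AllPairs.map ℕ.<⇒≢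

interval-unique : ∀ a n → Unique (interval a n)
interval-unique a n = increasing⇒unique (interval-increasing a n)

nth-interval : ∀ a n i → i < n → nth (interval a n) i ≡ a + i
nth-interval a (suc n) zero _ = sym (ℕ.+-identityʳ a)
nth-interval a (suc n) (suc i) (s≤s i<n) = trans (nth-interval (suc a) n i i<n) (sym (ℕ.+-suc a i))

Unique-resp-↭ : ∀ {xs ys : List ℕ} → xs ↭ ys → Unique xs → Unique ys
Unique-resp-↭ p = ↭ₛ.Unique-resp-↭ (setoid ℕ) (↭⇒↭ₛ p)

Unique-++⁻ˡ : ∀ (xs : List ℕ) {ys} → Unique (xs ++ ys) → Unique xs
Unique-++⁻ˡ [] u = []
Unique-++⁻ˡ (x ∷ xs) (x∉ ∷ u) = All.++⁻ˡ xs x∉ ∷ Unique-++⁻ˡ xs u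

Unique-++⁻ʳ : ∀ (xs : List ℕ) {ys} → Unique (xs ++ ys) → Unique ys
Unique-++⁻ʳ [] u = u
Unique-++⁻ʳ (x ∷ xs) (_ ∷ u) = Unique-++⁻ʳ xs u

Unique-++⇒disjoint : ∀ (xs : List ℕ) {ys z} → Unique (xs ++ ys) → z ∈ xs → z ∉ ys
Unique-++⇒disjoint (x ∷ xs) (x∉ ∷ u) (here refl) z∈ys = All.lookup x∉ (∈.∈-++⁺ʳ xs z∈ys) refl
Unique-++⇒disjoint (x ∷ xs) (_ ∷ u) (there z∈xs) = Unique-++⇒disjoint xs u z∈xs

private
  remove : ∀ {y : ℕ} ys → y ∈ ys → ∃ λ ys′ → (y ∷ ys′ ↭ ys) × (∀ {z} → z ∈ ys → z ≢ y → z ∈ ys′)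
  remove ys y∈ys with ∈.∈-∃++ y∈ys
  ... | as , bs , refl = as ++ bs , ↭-sym (↭.shift _ as bs) , keep
    where
    keep : ∀ {z} → z ∈ as ++ _ ∷ bs → z ≢ _ → z ∈ as ++ bs
    keep z∈ z≢y with ↭.∈-resp-↭ (↭.shift _ as bs) z∈
    ... | here z≡y = ⊥-elim (z≢y z≡y)
    ... | there z∈′ = z∈′

  head-∉ : ∀ {x : ℕ} {xs z} → Unique (x ∷ xs) → z ∈ xs → z ≢ x
  head-∉ u z∈ refl = Unique[x∷xs]⇒x∉xs u z∈

unique-⊆⇒length≤ : ∀ (xs ys : List ℕ) → Unique xs → (∀ {z} → z ∈ xs → z ∈ ys) → length xs ≤ length ys
unique-⊆⇒length≤ [] ys _ _ = z≤n
unique-⊆⇒length≤ (x ∷ xs) ys u sub with remove ys (sub (here refl))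
... | ys′ , p , keep = subst (suc (length xs) ≤_) (↭.↭-length p)
  (s≤s (unique-⊆⇒length≤ xs ys′ (AllPairs.tail u) λ z∈ → keep (sub (there z∈)) (head-∉ u z∈)))

unique-⊂⇒length< : ∀ (xs ys : List ℕ) {y} → Unique xs → (∀ {z} → z ∈ xs → z ∈ ys) → y ∈ ys → y ∉ xs →
  length xs < length ys
unique-⊂⇒length< xs ys u sub y∈ys y∉xs with remove ys y∈ys
... | ys′ , p , keep = subst (length xs <_) (↭.↭-length p)
  (s≤s (unique-⊆⇒length≤ xs ys′ u λ z∈ → keep (sub z∈) λ { refl → y∉xs z∈ }))

unique-⊆⊇⇒↭ : ∀ (xs ys : List ℕ) → Unique xs → Unique ys →
  (∀ {z} → z ∈ xs → z ∈ ys) → (∀ {z} → z ∈ ys → z ∈ xs) → xs ↭ ys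
unique-⊆⊇⇒↭ [] [] _ _ _ _ = ↭-refl
unique-⊆⊇⇒↭ [] (y ∷ ys) _ _ _ sup with sup (here refl)
... | ()
unique-⊆⊇⇒↭ (x ∷ xs) ys u uys sub sup with remove ys (sub (here refl))
... | ys′ , p , keep = ↭-trans (prep x rest) p
  where
  uys′ : Unique (x ∷ ys′)
  uys′ = Unique-resp-↭ (↭-sym p) uys
  back : ∀ {z} → z ∈ ys′ → z ∈ xs
  back z∈ with sup (↭.∈-resp-↭ p (there z∈))
  ... | here refl = ⊥-elim (Unique[x∷xs]⇒x∉xs uys′ z∈)
  ... | there z∈xs = z∈xs
  rest : xs ↭ ys′
  rest = unique-⊆⊇⇒↭ xs ys′ (AllPairs.tail u) (AllPairs.tail uys′) (λ z∈ → keep (sub (there z∈)) (head-∉ u z∈)) back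

module SetComp {n : ℕ} {Φ : SC} (sc : IsSetComp n Φ) where

  nonEmpty : All NonEmpty Φ
  nonEmpty = proj₁ sc

  increasing : All (Linked _<_) Φ
  increasing = proj₁ (proj₂ sc)

  ↭interval : concat Φ ↭ interval 1 n
  ↭interval = subst (concat Φ ↭_) (range≡interval n) (proj₂ (proj₂ sc))

  unique : Unique (concat Φ)
  unique = Unique-resp-↭ (↭-sym ↭interval) (interval-unique 1 n)

  ∈⇒bounded : ∀ {z} → z ∈ concat Φ → 1 ≤ z × z ≤ n
  ∈⇒bounded z∈ with ∈-interval⁻ 1 n (↭.∈-resp-↭ ↭interval z∈)
  ... | 1≤z , s≤s z≤max = 1≤z , z≤max

  bounded⇒∈ : ∀ {z} → 1 ≤ z → z ≤ n → z ∈ concat Φ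
  bounded⇒∈ 1≤z z≤max = ↭.∈-resp-↭ (↭-sym ↭interval) (∈-interval⁺ 1 n 1≤z (s≤s z≤max))

  size≡ : size Φ ≡ n
  size≡ = trans (↭.↭-length ↭interval) (length-interval 1 n)

  ofSize : IsSetComp (size Φ) Φ
  ofSize = subst (λ i → IsSetComp i Φ) (sym size≡) sc

mkSetComp : ∀ n Φ → All NonEmpty Φ → All (Linked _<_) Φ → Unique (concat Φ) →
  (∀ {z} → z ∈ concat Φ → 1 ≤ z × z ≤ n) → (∀ {z} → 1 ≤ z → z ≤ n → z ∈ concat Φ) → IsSetComp n Φ
mkSetComp n Φ ne inc u bounded ∈ = ne , inc , subst (concat Φ ↭_) (sym (range≡interval n))
  (unique-⊆⊇⇒↭ (concat Φ) (interval 1 n) u (interval-unique 1 n)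
    (λ z∈ → let (1≤z , z≤max) = bounded z∈ in ∈-interval⁺ 1 n 1≤z (s≤s z≤max))
    (λ z∈ → let (1≤z , z<1+n) = ∈-interval⁻ 1 n z∈ in ∈ 1≤z (ℕ.≤-pred z<1+n)))

≤-maxL : ∀ {x} xs → x ∈ xs → x ≤ maxL xs
≤-maxL (y ∷ xs) (here refl) = ℕ.m≤m⊔n y (maxL xs)
≤-maxL (y ∷ xs) (there x∈) = ℕ.≤-trans (≤-maxL xs x∈) (ℕ.m≤n⊔m y (maxL xs))

maxL-least : ∀ {b} xs → (∀ {x} → x ∈ xs → x ≤ b) → maxL xs ≤ b
maxL-least [] _ = z≤n
maxL-least (y ∷ xs) ub = ℕ.⊔-lub (ub (here refl)) (maxL-least xs (ub ∘ there))

maxL-++ : ∀ xs ys → maxL (xs ++ ys) ≡ maxL xs ⊔ maxL ys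
maxL-++ [] ys = refl
maxL-++ (x ∷ xs) ys = trans (cong (x ⊔_) (maxL-++ xs ys)) (sym (ℕ.⊔-assoc x (maxL xs) (maxL ys)))

maxL-∈ : ∀ xs → xs ≢ [] → maxL xs ∈ xs
maxL-∈ [] ne = ⊥-elim (ne refl)
maxL-∈ (x ∷ []) _ = here (ℕ.⊔-identityʳ x)
maxL-∈ (x ∷ y ∷ xs) _ = [ here , (λ max≡ → there (subst (_∈ y ∷ xs) (sym max≡) (maxL-∈ (y ∷ xs) λ ()))) ]′
  (ℕ.⊔-sel x (maxL (y ∷ xs)))

downClosed⇒∈ : ∀ L → (∀ {z w} → z ∈ L → 1 ≤ w → w < z → w ∈ L) → ∀ {z} → 1 ≤ z → z ≤ maxL L → z ∈ L
downClosed⇒∈ [] _ 1≤z z≤0 with ℕ.≤-trans 1≤z z≤0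
... | ()
downClosed⇒∈ (x ∷ L) closed 1≤z z≤max with ℕ.m≤n⇒m<n∨m≡n z≤max
... | inj₁ z<max = closed (maxL-∈ (x ∷ L) λ ()) 1≤z z<max
... | inj₂ refl = maxL-∈ (x ∷ L) λ ()

relabel : (ℕ → ℕ) → SC → SC
relabel f = map (map f)

relabel-∘ : ∀ g f X → relabel g (relabel f X) ≡ relabel (g ∘ f) X
relabel-∘ g f [] = refl
relabel-∘ g f (B ∷ X) = cong₂ _∷_ (sym (List.map-∘ B)) (relabel-∘ g f X)

relabel-cong : ∀ {g h} X → (∀ {x} → x ∈ concat X → g x ≡ h x) → relabel g X ≡ relabel h X
relabel-cong [] _ = refl
relabel-cong (B ∷ X) g≗h = cong₂ _∷_
  (List.map-cong-local (All.tabulate (g≗h ∘ ∈.∈-++⁺ˡ))) (relabel-cong X (g≗h ∘ ∈.∈-++⁺ʳ B))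

relabel-id : ∀ X → relabel id X ≡ X
relabel-id [] = refl
relabel-id (B ∷ X) = cong₂ _∷_ (List.map-id B) (relabel-id X)

relabel-nonEmpty : ∀ f X → All NonEmpty X → All NonEmpty (relabel f X)
relabel-nonEmpty f [] [] = []
relabel-nonEmpty f ([] ∷ X) (ne ∷ _) = ⊥-elim (ne refl)
relabel-nonEmpty f ((x ∷ B) ∷ X) (_ ∷ nes) = (λ ()) ∷ relabel-nonEmpty f X nes

MonotoneOn : (ℕ → ℕ) → List ℕ → Set
MonotoneOn f L = ∀ {x y} → x ∈ L → y ∈ L → x < y → f x < f y

MonotoneOn-⊆ : ∀ {f L L′} → MonotoneOn f L → (∀ {z} → z ∈ L′ → z ∈ L) → MonotoneOn f L′
MonotoneOn-⊆ mono sub x∈ y∈ = mono (sub x∈) (sub y∈)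

MonotoneOn-reflects-< : ∀ {f L x y} → MonotoneOn f L → x ∈ L → y ∈ L → f x < f y → x < y
MonotoneOn-reflects-< {x = x} {y} mono x∈ y∈ fx<fy with ℕ.<-cmp x y
... | tri< x<y _ _ = x<y
... | tri≈ _ refl _ = ⊥-elim (ℕ.<-irrefl refl fx<fy)
... | tri> _ _ y<x = ⊥-elim (ℕ.<-asym fx<fy (mono y∈ x∈ y<x))

+-monotoneOn : ∀ m L → MonotoneOn (_+ m) L
+-monotoneOn m L _ _ = ℕ.+-monoˡ-< m

monotone⇒linked : ∀ f B → MonotoneOn f B → Linked _<_ B → Linked _<_ (map f B)
monotone⇒linked f [] _ [] = []
monotone⇒linked f (x ∷ []) _ [-] = [-]
monotone⇒linked f (x ∷ y ∷ B) mono (x<y ∷ inc) =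
  mono (here refl) (there (here refl)) x<y ∷ monotone⇒linked f (y ∷ B) (MonotoneOn-⊆ mono there) inc

relabel-increasing : ∀ f X → MonotoneOn f (concat X) → All (Linked _<_) X → All (Linked _<_) (relabel f X)
relabel-increasing f [] _ [] = []
relabel-increasing f (B ∷ X) mono (inc ∷ incs) =
  monotone⇒linked f B (MonotoneOn-⊆ mono ∈.∈-++⁺ˡ) inc ∷ relabel-increasing f X (MonotoneOn-⊆ mono (∈.∈-++⁺ʳ B)) incs

monotone⇒unique : ∀ f xs → MonotoneOn f xs → Unique xs → Unique (map f xs)
monotone⇒unique f [] _ [] = []
monotone⇒unique f (x ∷ xs) mono (x∉ ∷ u) =
  All.tabulate (λ w∈ → fx≢ (∈.∈-map⁻ f w∈)) ∷ monotone⇒unique f xs (MonotoneOn-⊆ mono there) u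
  where
  fx≢ : ∀ {w} → ∃ (λ y → y ∈ xs × w ≡ f y) → f x ≢ w
  fx≢ (y , y∈ , refl) fx≡fy with ℕ.<-cmp x y
  ... | tri< x<y _ _ = ℕ.<-irrefl fx≡fy (mono (here refl) (there y∈) x<y)
  ... | tri≈ _ refl _ = All.lookup x∉ y∈ refl
  ... | tri> _ _ y<x = ℕ.<-irrefl (sym fx≡fy) (mono (there y∈) (here refl) y<x)

countBelow : ℕ → List ℕ → ℕ
countBelow x L = length (filter (_<? x) L)

-- st X unfolds to relabel (rankOf (concat X)) X.
rankOf : List ℕ → ℕ → ℕ
rankOf L x = suc (countBelow x L)

countBelow-∷-< : ∀ {x z} L → z < x → countBelow x (z ∷ L) ≡ suc (countBelow x L)
countBelow-∷-< {x} L z<x = cong length (List.filter-accept (_<? x) z<x)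

countBelow-∷-≮ : ∀ {x z} L → ¬ z < x → countBelow x (z ∷ L) ≡ countBelow x L
countBelow-∷-≮ {x} L z≮x = cong length (List.filter-reject (_<? x) z≮x)

countBelow-map : ∀ f {L} → MonotoneOn f L → ∀ {x} → x ∈ L → ∀ L′ → (∀ {z} → z ∈ L′ → z ∈ L) →
  countBelow (f x) (map f L′) ≡ countBelow x L′
countBelow-map f mono x∈ [] _ = refl
countBelow-map f {L} mono {x} x∈ (z ∷ L′) sub with z <? x | f z <? f x
... | yes z<x | yes fz<fx = trans (countBelow-∷-< (map f L′) fz<fx)
  (trans (cong suc (countBelow-map f mono x∈ L′ (sub ∘ there))) (sym (countBelow-∷-< L′ z<x)))
... | no z≮x | no fz≮fx = trans (countBelow-∷-≮ (map f L′) fz≮fx)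
  (trans (countBelow-map f mono x∈ L′ (sub ∘ there)) (sym (countBelow-∷-≮ L′ z≮x)))
... | yes z<x | no fz≮fx = ⊥-elim (fz≮fx (mono (sub (here refl)) x∈ z<x))
... | no z≮x | yes fz<fx = ⊥-elim (z≮x (MonotoneOn-reflects-< mono (sub (here refl)) x∈ fz<fx))

countBelow-mono-≤ : ∀ {x y} → x ≤ y → ∀ L → countBelow x L ≤ countBelow y L
countBelow-mono-≤ x≤y [] = z≤n
countBelow-mono-≤ {x} {y} x≤y (z ∷ L) with z <? x | z <? y
... | yes z<x | yes z<y = subst₂ _≤_ (sym (countBelow-∷-< L z<x)) (sym (countBelow-∷-< L z<y)) (s≤s (countBelow-mono-≤ x≤y L))
... | no z≮x | yes z<y = subst₂ _≤_ (sym (countBelow-∷-≮ L z≮x)) (sym (countBelow-∷-< L z<y)) (ℕ.m≤n⇒m≤1+n (countBelow-mono-≤ x≤y L))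
... | no z≮x | no z≮y = subst₂ _≤_ (sym (countBelow-∷-≮ L z≮x)) (sym (countBelow-∷-≮ L z≮y)) (countBelow-mono-≤ x≤y L)
... | yes z<x | no z≮y = ⊥-elim (z≮y (ℕ.<-≤-trans z<x x≤y))

countBelow-mono-< : ∀ {x y} L → x ∈ L → x < y → countBelow x L < countBelow y L
countBelow-mono-< {x} {y} (z ∷ L) z∈ x<y with z <? x | z <? y
... | yes z<x | yes z<y = subst₂ _<_ (sym (countBelow-∷-< L z<x)) (sym (countBelow-∷-< L z<y)) (s≤s (below L z∈))
  where
  below : ∀ L → x ∈ z ∷ L → countBelow x L < countBelow y L
  below L (here refl) = ⊥-elim (ℕ.<-irrefl refl z<x)
  below L (there x∈L) = countBelow-mono-< L x∈L x<y
... | no z≮x | yes z<y = subst₂ _<_ (sym (countBelow-∷-≮ L z≮x)) (sym (countBelow-∷-< L z<y)) (s≤s (countBelow-mono-≤ (ℕ.<⇒≤ x<y) L))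
... | no z≮x | no z≮y = subst₂ _<_ (sym (countBelow-∷-≮ L z≮x)) (sym (countBelow-∷-≮ L z≮y)) (below z∈)
  where
  below : x ∈ z ∷ L → countBelow x L < countBelow y L
  below (here refl) = ⊥-elim (z≮y x<y)
  below (there x∈L) = countBelow-mono-< L x∈L x<y
... | yes z<x | no z≮y = ⊥-elim (z≮y (ℕ.<-trans z<x x<y))

rank-monotone : ∀ L → MonotoneOn (rankOf L) L
rank-monotone L x∈ _ x<y = s≤s (countBelow-mono-< L x∈ x<y)

st-relabel : ∀ f X → MonotoneOn f (concat X) → st (relabel f X) ≡ st X
st-relabel f X mono = begin
    relabel (rankOf (concat (relabel f X))) (relabel f X)
  ≡⟨ cong (λ L → relabel (rankOf L) (relabel f X)) (List.concat-map X) ⟩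
    relabel (rankOf (map f (concat X))) (relabel f X)
  ≡⟨ relabel-∘ (rankOf (map f (concat X))) f X ⟩
    relabel (rankOf (map f (concat X)) ∘ f) X
  ≡⟨ relabel-cong X (λ x∈ → cong suc (countBelow-map f mono x∈ (concat X) id)) ⟩
    relabel (rankOf (concat X)) X
  ∎
  where open ≡-Reasoning

countBelow-interval : ∀ x a n → a ≤ x → x ≤ a + n → countBelow x (interval a n) ≡ x ∸ a
countBelow-interval x a zero a≤x x≤a+0 with ℕ.≤-antisym a≤x (subst (x ≤_) (ℕ.+-identityʳ a) x≤a+0)
... | refl = sym (ℕ.n∸n≡0 a)
countBelow-interval x a (suc n) a≤x x≤a+n with a <? x
... | yes a<x = trans (countBelow-∷-< (interval (suc a) n) a<x)
  (trans (cong suc (countBelow-interval x (suc a) n a<x (subst (x ≤_) (ℕ.+-suc a n) x≤a+n)))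
         (sym (ℕ.+-∸-assoc 1 a<x)))
... | no a≮x with ℕ.≤-antisym a≤x (ℕ.≮⇒≥ a≮x)
... | refl = trans (countBelow-∷-≮ (interval (suc a) n) a≮x)
  (trans (countBelow-interval-below (suc a) n (ℕ.n≤1+n a)) (sym (ℕ.n∸n≡0 a)))
  where
  countBelow-interval-below : ∀ b m → x ≤ b → countBelow x (interval b m) ≡ 0
  countBelow-interval-below b zero _ = refl
  countBelow-interval-below b (suc m) x≤b with b <? x
  ... | yes b<x = ⊥-elim (ℕ.<-irrefl refl (ℕ.<-≤-trans b<x x≤b))
  ... | no b≮x = trans (countBelow-∷-≮ (interval (suc b) m) b≮x) (countBelow-interval-below (suc b) m (ℕ.m≤n⇒m≤1+n x≤b))

st-setComp : ∀ {n Φ} → IsSetComp n Φ → st Φ ≡ Φ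
st-setComp {n} {Φ} sc = trans (relabel-cong Φ rank≡) (relabel-id Φ)
  where
  open SetComp sc
  rank≡ : ∀ {x} → x ∈ concat Φ → rankOf (concat Φ) x ≡ x
  rank≡ {x} x∈ with ∈⇒bounded x∈
  ... | 1≤x@(s≤s _) , x≤n = cong suc (trans (↭.↭-length (↭.filter-↭ (_<? x) ↭interval))
    (countBelow-interval x 1 n 1≤x (ℕ.m≤n⇒m≤1+n x≤n)))

-- Cuts and the decomposition Φ|Γ

module _ {A : Set} where

  take-take-≤ : ∀ j k (xs : List A) → j ≤ k → take j (take k xs) ≡ take j xs
  take-take-≤ j k xs j≤k = trans (List.take-take j k xs) (cong (λ i → take i xs) (ℕ.m≤n⇒m⊓n≡m j≤k))

  drop-≤ : ∀ j k (xs : List A) → j ≤ k → drop j xs ≡ drop j (take k xs) ++ drop k xs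
  drop-≤ zero k xs _ = sym (List.take++drop≡id k xs)
  drop-≤ (suc j) (suc k) [] _ = refl
  drop-≤ (suc j) (suc k) (x ∷ xs) (s≤s j≤k) = drop-≤ j k xs j≤k

  take-+ : ∀ l k (xs : List A) → take (l + k) xs ≡ take l xs ++ take k (drop l xs)
  take-+ zero k xs = refl
  take-+ (suc l) k [] = sym (List.take-[] k)
  take-+ (suc l) k (x ∷ xs) = cong (x ∷_) (take-+ l k xs)

  take-++-length : ∀ (xs ys : List A) → take (length xs) (xs ++ ys) ≡ xs
  take-++-length [] ys = refl
  take-++-length (x ∷ xs) ys = cong (x ∷_) (take-++-length xs ys)

  drop-++-length : ∀ (xs ys : List A) → drop (length xs) (xs ++ ys) ≡ ys
  drop-++-length [] ys = refl
  drop-++-length (x ∷ xs) ys = drop-++-length xs ys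

  take-nonEmpty : ∀ (xs : List A) {k} → 1 ≤ k → k ≤ length xs → xs ≢ [] → take k xs ≢ []
  take-nonEmpty [] _ _ xs≢[] = ⊥-elim (xs≢[] refl)
  take-nonEmpty (_ ∷ _) (s≤s _) _ _ ()

  drop-nonEmpty : ∀ (xs : List A) k → k < length xs → drop k xs ≢ []
  drop-nonEmpty (_ ∷ _) zero _ ()
  drop-nonEmpty (_ ∷ xs) (suc k) (s≤s k<len) = drop-nonEmpty xs k k<len

  length-take-≤ : ∀ k (xs : List A) → k ≤ length xs → length (take k xs) ≡ k
  length-take-≤ k xs k≤ = trans (List.length-take k xs) (ℕ.m≤n⇒m⊓n≡m k≤)

concat-take++drop : ∀ k (X : SC) → concat (take k X) ++ concat (drop k X) ≡ concat X
concat-take++drop k X = trans (List.concat-++ (take k X) (drop k X)) (cong concat (List.take++drop≡id k X))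

∈-take⇒∈ : ∀ {z} k X → z ∈ concat (take k X) → z ∈ concat X
∈-take⇒∈ k X z∈ = subst (_ ∈_) (concat-take++drop k X) (∈.∈-++⁺ˡ z∈)

∈-drop⇒∈ : ∀ {z} k X → z ∈ concat (drop k X) → z ∈ concat X
∈-drop⇒∈ k X z∈ = subst (_ ∈_) (concat-take++drop k X) (∈.∈-++⁺ʳ (concat (take k X)) z∈)

Separated : List ℕ → List ℕ → Set
Separated xs ys = ∀ {x y} → x ∈ xs → y ∈ ys → x < y

separated? : ∀ xs ys → Dec (Separated xs ys)
separated? xs ys = map′ (λ s x∈ y∈ → All.lookup (All.lookup s x∈) y∈)
  (λ s → All.tabulate λ x∈ → All.tabulate λ y∈ → s x∈ y∈)
  (All.all? (λ x → All.all? (x <?_) ys) xs)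

separated-relabel : ∀ f xs ys → MonotoneOn f (xs ++ ys) → Separated (map f xs) (map f ys) ⇔ Separated xs ys
separated-relabel f xs ys mono = mk⇔ reflect preserve
  where
  reflect : Separated (map f xs) (map f ys) → Separated xs ys
  reflect s x∈ y∈ = MonotoneOn-reflects-< mono (∈.∈-++⁺ˡ x∈) (∈.∈-++⁺ʳ xs y∈) (s (∈.∈-map⁺ f x∈) (∈.∈-map⁺ f y∈))
  mapped : ∀ {a b} → Separated xs ys → ∃ (λ x → x ∈ xs × a ≡ f x) → ∃ (λ y → y ∈ ys × b ≡ f y) → a < b
  mapped s (x , x∈ , refl) (y , y∈ , refl) = mono (∈.∈-++⁺ˡ x∈) (∈.∈-++⁺ʳ xs y∈) (s x∈ y∈)
  preserve : Separated xs ys → Separated (map f xs) (map f ys)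
  preserve s fx∈ fy∈ = mapped s (∈.∈-map⁻ f fx∈) (∈.∈-map⁻ f fy∈)

Cut : SC → ℕ → Set
Cut X j = Separated (concat (take j X)) (concat (drop j X))

cut? : ∀ X j → Dec (Cut X j)
cut? X j = separated? (concat (take j X)) (concat (drop j X))

Cut-zero : ∀ X → Cut X 0
Cut-zero X ()

Cut-length : ∀ X → Cut X (length X)
Cut-length X _ y∈ with subst (λ Z → _ ∈ concat Z) (List.drop-all (length X) X ℕ.≤-refl) y∈
... | ()

Cut-relabel : ∀ f X j → MonotoneOn f (concat X) → Cut (relabel f X) j ⇔ Cut X j
Cut-relabel f X j mono =
  subst₂ (λ xs ys → Separated xs ys ⇔ Cut X j)
    (sym (trans (cong concat (List.take-map j X)) (List.concat-map (take j X))))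
    (sym (trans (cong concat (List.drop-map j X)) (List.concat-map (drop j X))))
    (separated-relabel f (concat (take j X)) (concat (drop j X))
      (MonotoneOn-⊆ mono (subst (_ ∈_) (concat-take++drop j X))))

Cut-take : ∀ j k X → j ≤ k → Cut X j → Cut (take k X) j
Cut-take j k X j≤k cut x∈ y∈ =
  cut (subst (λ Z → _ ∈ concat Z) (take-take-≤ j k X j≤k) x∈)
      (subst (λ Z → _ ∈ concat Z) (sym (drop-≤ j k X j≤k))
        (subst (_ ∈_) (List.concat-++ (drop j (take k X)) (drop k X)) (∈.∈-++⁺ˡ y∈)))

Cut-drop : ∀ l k X → Cut X (l + k) → Cut (drop l X) k
Cut-drop l k X cut x∈ y∈ =
  cut (subst (λ Z → _ ∈ concat Z) (sym (take-+ l k X))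
        (subst (_ ∈_) (List.concat-++ (take l X) (take k (drop l X))) (∈.∈-++⁺ʳ (concat (take l X)) x∈)))
      (subst (λ Z → _ ∈ concat Z) (List.drop-drop l k X) y∈)

Cut-take⇒Cut : ∀ j k X → j ≤ k → Cut (take k X) j → Cut X k → Cut X j
Cut-take⇒Cut j k X j≤k cutj cutk {x} x∈ y∈
  with ∈.∈-++⁻ (concat (drop j (take k X)))
         (subst (_ ∈_) (sym (List.concat-++ (drop j (take k X)) (drop k X)))
           (subst (λ Z → _ ∈ concat Z) (drop-≤ j k X j≤k) y∈))
... | inj₁ y∈mid = cutj (subst (λ Z → x ∈ concat Z) (sym (take-take-≤ j k X j≤k)) x∈) y∈mid
... | inj₂ y∈rest = cutk (∈-take⇒∈ j (take k X) (subst (λ Z → x ∈ concat Z) (sym (take-take-≤ j k X j≤k)) x∈)) y∈rest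

concat-shift : ∀ m J → concat (shift m J) ≡ map (_+ m) (concat J)
concat-shift m J = List.concat-map J

∈-shift⁻ : ∀ {z} m J → z ∈ concat (shift m J) → ∃ λ y → y ∈ concat J × z ≡ y + m
∈-shift⁻ m J z∈ = ∈.∈-map⁻ (_+ m) (subst (_ ∈_) (concat-shift m J) z∈)

concat-bar : ∀ m (A J : SC) → concat (bar m A J) ≡ concat A ++ map (_+ m) (concat J)
concat-bar m A J = trans (sym (List.concat-++ A (shift m J))) (cong (concat A ++_) (concat-shift m J))

bar-setComp : ∀ {m k A J} → IsSetComp m A → IsSetComp k J → IsSetComp (m + k) (bar m A J)
bar-setComp {m} {k} {A} {J} scA scJ = mkSetComp (m + k) (bar m A J)
  (All.++⁺ A.nonEmpty (relabel-nonEmpty (_+ m) J J.nonEmpty))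
  (All.++⁺ A.increasing (relabel-increasing (_+ m) J (+-monotoneOn m (concat J)) J.increasing))
  (subst Unique (sym (concat-bar m A J)) (Unique-++⁺ A.unique
     (monotone⇒unique (_+ m) (concat J) (+-monotoneOn m (concat J)) J.unique) λ (z∈A , z∈J) → disjoint z∈A z∈J))
  (λ z∈ → bounded (∈.∈-++⁻ (concat A) (subst (_ ∈_) (concat-bar m A J) z∈)))
  (λ 1≤z z≤m+k → subst (_ ∈_) (sym (concat-bar m A J)) (covered 1≤z z≤m+k))
  where
  module A = SetComp scA
  module J = SetComp scJ
  disjoint : ∀ {z} → z ∈ concat A → z ∉ map (_+ m) (concat J)
  disjoint z∈A z∈J with ∈.∈-map⁻ (_+ m) z∈J
  ... | y , y∈ , refl = ℕ.<-irrefl refl (ℕ.<-≤-trans (ℕ.+-monoˡ-≤ m (proj₁ (J.∈⇒bounded y∈))) (proj₂ (A.∈⇒bounded z∈A)))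
  bounded : ∀ {z} → z ∈ concat A ⊎ z ∈ map (_+ m) (concat J) → 1 ≤ z × z ≤ m + k
  bounded (inj₁ z∈) = proj₁ (A.∈⇒bounded z∈) , ℕ.≤-trans (proj₂ (A.∈⇒bounded z∈)) (ℕ.m≤m+n m k)
  bounded (inj₂ z∈) with ∈.∈-map⁻ (_+ m) z∈
  ... | y , y∈ , refl = ℕ.≤-trans (proj₁ (J.∈⇒bounded y∈)) (ℕ.m≤m+n y m) ,
        subst (y + m ≤_) (ℕ.+-comm k m) (ℕ.+-monoˡ-≤ m (proj₂ (J.∈⇒bounded y∈)))
  covered : ∀ {z} → 1 ≤ z → z ≤ m + k → z ∈ concat A ++ map (_+ m) (concat J)
  covered {z} 1≤z z≤m+k with z ≤? m
  ... | yes z≤m = ∈.∈-++⁺ˡ (A.bounded⇒∈ 1≤z z≤m)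
  ... | no z≰m = ∈.∈-++⁺ʳ (concat A) (subst (_∈ map (_+ m) (concat J)) (ℕ.m∸n+n≡m (ℕ.<⇒≤ m<z))
        (∈.∈-map⁺ (_+ m) (J.bounded⇒∈ (ℕ.m<n⇒0<n∸m m<z) (subst (z ∸ m ≤_) (ℕ.m+n∸m≡n m k) (ℕ.∸-monoˡ-≤ m z≤m+k)))))
    where
    m<z : m < z
    m<z = ℕ.≰⇒> z≰m

take-bar : ∀ m (A J : SC) b → take (length A + b) (bar m A J) ≡ A ++ take b (shift m J)
take-bar m A J b = trans (take-+ (length A) b (A ++ shift m J))
  (cong₂ (λ X Y → X ++ take b Y) (take-++-length A (shift m J)) (drop-++-length A (shift m J)))

drop-bar : ∀ m (A J : SC) b → drop (length A + b) (bar m A J) ≡ drop b (shift m J)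
drop-bar m A J b = trans (sym (List.drop-drop (length A) b (A ++ shift m J))) (cong (drop b) (drop-++-length A (shift m J)))

shift-above : ∀ {k y} m J → IsSetComp k J → y ∈ concat (shift m J) → m < y
shift-above m J scJ y∈ with ∈-shift⁻ m J y∈
... | y′ , y′∈ , refl = subst (_< y′ + m) (ℕ.+-identityˡ m) (ℕ.+-monoˡ-≤ m (proj₁ (SetComp.∈⇒bounded scJ y′∈)))

Cut-bar : ∀ {m k A J} b → IsSetComp m A → IsSetComp k J → Cut J b → Cut (bar m A J) (length A + b)
Cut-bar {m} {k} {A} {J} b scA scJ cut x∈ y∈ =
  separate (∈.∈-++⁻ (concat A) (subst (_ ∈_) (sym (List.concat-++ A (take b (shift m J))))
    (subst (λ Z → _ ∈ concat Z) (take-bar m A J b) x∈)))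
  where
  y∈S : _ ∈ concat (drop b (shift m J))
  y∈S = subst (λ Z → _ ∈ concat Z) (drop-bar m A J b) y∈
  separate : ∀ {x} → x ∈ concat A ⊎ x ∈ concat (take b (shift m J)) → x < _
  separate (inj₁ x∈A) = ℕ.≤-<-trans (proj₂ (SetComp.∈⇒bounded scA x∈A)) (shift-above m J scJ (∈-drop⇒∈ b (shift m J) y∈S))
  separate (inj₂ x∈S) = Equivalence.from (Cut-relabel (_+ m) J b (+-monotoneOn m (concat J))) cut x∈S y∈S

unshift-setComp : ∀ m n Y → m ≤ n → All NonEmpty Y → All (Linked _<_) Y → Unique (concat Y) →
  (∀ {z} → z ∈ concat Y → m < z × z ≤ n) → (∀ {z} → m < z → z ≤ n → z ∈ concat Y) →
  IsSetComp (n ∸ m) (relabel (_∸ m) Y) × Y ≡ shift m (relabel (_∸ m) Y)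
unshift-setComp m n Y m≤n ne inc u bounded covered =
  mkSetComp (n ∸ m) (relabel (_∸ m) Y) (relabel-nonEmpty (_∸ m) Y ne) (relabel-increasing (_∸ m) Y mono inc)
    (subst Unique (sym concat≡) (monotone⇒unique (_∸ m) (concat Y) mono u))
    (λ z∈ → bounded′ (∈.∈-map⁻ (_∸ m) (subst (_ ∈_) concat≡ z∈)))
    (λ {z} 1≤z z≤n∸m → subst (_ ∈_) (sym concat≡) (subst (_∈ map (_∸ m) (concat Y)) (ℕ.m+n∸n≡m z m)
       (∈.∈-map⁺ (_∸ m) (covered (subst (m <_) (ℕ.+-comm m z) (ℕ.m<m+n m 1≤z))
         (subst (z + m ≤_) (ℕ.m∸n+n≡m m≤n) (ℕ.+-monoˡ-≤ m z≤n∸m))))))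
  , sym (trans (relabel-∘ (_+ m) (_∸ m) Y)
      (trans (relabel-cong Y (λ z∈ → ℕ.m∸n+n≡m (ℕ.<⇒≤ (proj₁ (bounded z∈))))) (relabel-id Y)))
  where
  concat≡ : concat (relabel (_∸ m) Y) ≡ map (_∸ m) (concat Y)
  concat≡ = List.concat-map Y
  mono : MonotoneOn (_∸ m) (concat Y)
  mono x∈ _ x<y = ℕ.∸-monoˡ-< x<y (ℕ.<⇒≤ (proj₁ (bounded x∈)))
  bounded′ : ∀ {z} → ∃ (λ y → y ∈ concat Y × z ≡ y ∸ m) → 1 ≤ z × z ≤ n ∸ m
  bounded′ (y , y∈ , refl) = ℕ.m<n⇒0<n∸m (proj₁ (bounded y∈)) , ℕ.∸-monoˡ-≤ m (proj₂ (bounded y∈))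

record Decomposition (n : ℕ) (Ψ : SC) (k : ℕ) : Set where
  field
    m : ℕ
    right : SC
    left-setComp : IsSetComp m (take k Ψ)
    right-setComp : IsSetComp (n ∸ m) right
    drop≡shift : drop k Ψ ≡ shift m right

  ≡bar : Ψ ≡ bar m (take k Ψ) right
  ≡bar = trans (sym (List.take++drop≡id k Ψ)) (cong (take k Ψ ++_) drop≡shift)

-- The entries before a cut form an initial segment [m] of [n], so a cut splits Ψ as Φ|Γ.
module _ {n Ψ} (sc : IsSetComp n Ψ) {k} (cut : Cut Ψ k) where
  private
    module Ψ = SetComp sc
    xs ys : List ℕ
    xs = concat (take k Ψ)
    ys = concat (drop k Ψ)
    m = maxL xs

    U : Unique (xs ++ ys)
    U = subst Unique (sym (concat-take++drop k Ψ)) Ψ.unique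

    bounded : ∀ {z} → z ∈ xs ++ ys → 1 ≤ z × z ≤ n
    bounded z∈ = Ψ.∈⇒bounded (subst (_ ∈_) (concat-take++drop k Ψ) z∈)

    covered : ∀ {z} → 1 ≤ z → z ≤ n → z ∈ xs ++ ys
    covered 1≤z z≤N = subst (_ ∈_) (sym (concat-take++drop k Ψ)) (Ψ.bounded⇒∈ 1≤z z≤N)

    down-closed : ∀ {z w} → z ∈ xs → 1 ≤ w → w < z → w ∈ xs
    down-closed z∈ 1≤w w<z with ∈.∈-++⁻ xs (covered 1≤w (ℕ.≤-trans (ℕ.<⇒≤ w<z) (proj₂ (bounded (∈.∈-++⁺ˡ z∈)))))
    ... | inj₁ w∈xs = w∈xs
    ... | inj₂ w∈ys = ⊥-elim (ℕ.<-asym w<z (cut z∈ w∈ys))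

    ys-above : ∀ {z} → z ∈ ys → m < z × z ≤ n
    ys-above {z} z∈ with bounded (∈.∈-++⁺ʳ xs z∈)
    ... | 1≤z , z≤N with m <? z
    ...   | yes m<z = m<z , z≤N
    ...   | no m≮z = ⊥-elim (Unique-++⇒disjoint xs U (downClosed⇒∈ xs down-closed 1≤z (ℕ.≮⇒≥ m≮z)) z∈)

    ys-covered : ∀ {z} → m < z → z ≤ n → z ∈ ys
    ys-covered m<z z≤N with ∈.∈-++⁻ xs (covered (ℕ.≤-trans (s≤s z≤n) m<z) z≤N)
    ... | inj₁ z∈xs = ⊥-elim (ℕ.<-irrefl refl (ℕ.<-≤-trans m<z (≤-maxL xs z∈xs)))
    ... | inj₂ z∈ys = z∈ys

    right-part = unshift-setComp m n (drop k Ψ)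
      (maxL-least xs (λ z∈ → proj₂ (bounded (∈.∈-++⁺ˡ z∈))))
      (All.drop⁺ k Ψ.nonEmpty) (All.drop⁺ k Ψ.increasing) (Unique-++⁻ʳ xs U) ys-above ys-covered

  cut⇒decomposition : Decomposition n Ψ k
  cut⇒decomposition = record
    { m = m
    ; right = relabel (_∸ m) (drop k Ψ)
    ; left-setComp = mkSetComp m (take k Ψ) (All.take⁺ k Ψ.nonEmpty) (All.take⁺ k Ψ.increasing) (Unique-++⁻ˡ xs U)
        (λ z∈ → proj₁ (bounded (∈.∈-++⁺ˡ z∈)) , ≤-maxL xs z∈) (downClosed⇒∈ xs down-closed)
    ; right-setComp = proj₁ right-part
    ; drop≡shift = proj₂ right-part
    }

-- Atomic factorization

atomic-setComp : ∀ {A} → Atomic A → IsSetComp (size A) A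
atomic-setComp (n , sc , _) = SetComp.ofSize sc

atomic-size : ∀ {A} → Atomic A → 1 ≤ size A
atomic-size (n , sc , 1≤n , _) = subst (1 ≤_) (sym (SetComp.size≡ sc)) 1≤n

atomic-length : ∀ {A} → Atomic A → 1 ≤ length A
atomic-length {[]} at with atomic-size at
... | ()
atomic-length {_ ∷ _} _ = s≤s z≤n

atomic⇒¬Cut : ∀ {A} → Atomic A → ∀ k → 1 ≤ k → k < length A → ¬ Cut A k
atomic⇒¬Cut {A} (n , sc , _ , indecomposable) k 1≤k k<len cut = indecomposable
  (m , n ∸ m , take k A , right , left-setComp , right-setComp , left-nonEmpty , right-nonEmpty , ≡bar)
  where
  open Decomposition (cut⇒decomposition sc {k} cut)
  left-nonEmpty : take k A ≢ []
  left-nonEmpty = take-nonEmpty A 1≤k (ℕ.<⇒≤ k<len) λ A≡[] → ℕ.n≮0 (subst (λ Z → k < length Z) A≡[] k<len)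
  right-nonEmpty : right ≢ []
  right-nonEmpty right≡[] = drop-nonEmpty A k k<len (trans drop≡shift (cong (shift m) right≡[]))

-- The least index in [j, j + r] satisfying a decidable predicate (j + r if there is none)

module _ {P : ℕ → Set} (P? : ∀ i → Dec (P i)) where

  search : ℕ → ℕ → ℕ
  search j zero = j
  search j (suc r) = if does (P? j) then j else search (suc j) r

  search-≥ : ∀ j r → j ≤ search j r
  search-≥ j zero = ℕ.≤-refl
  search-≥ j (suc r) with P? j
  ... | yes _ = ℕ.≤-refl
  ... | no _ = ℕ.<⇒≤ (search-≥ (suc j) r)

  search-≤ : ∀ j r → search j r ≤ j + r
  search-≤ j zero = ℕ.m≤m+n j 0
  search-≤ j (suc r) with P? j
  ... | yes _ = ℕ.m≤m+n j (suc r)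
  ... | no _ = subst (search (suc j) r ≤_) (sym (ℕ.+-suc j r)) (search-≤ (suc j) r)

  search-holds : ∀ j r → P (j + r) → P (search j r)
  search-holds j zero p = subst P (ℕ.+-identityʳ j) p
  search-holds j (suc r) p with P? j
  ... | yes pj = pj
  ... | no _ = search-holds (suc j) r (subst P (ℕ.+-suc j r) p)

  search-minimal : ∀ j r i → j ≤ i → i < search j r → ¬ P i
  search-minimal j zero i j≤i i<j = ⊥-elim (ℕ.<-irrefl refl (ℕ.<-≤-trans i<j j≤i))
  search-minimal j (suc r) i j≤i i< with P? j
  ... | yes _ = ⊥-elim (ℕ.<-irrefl refl (ℕ.<-≤-trans i< j≤i))
  ... | no ¬pj with ℕ.m≤n⇒m<n∨m≡n j≤i
  ...   | inj₁ j<i = search-minimal (suc j) r i j<i i<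
  ...   | inj₂ refl = ¬pj

-- The first atomic factor of a set composition ends at its first nontrivial cut.

firstCut : SC → ℕ
firstCut X = search (cut? X) 1 (length X ∸ 1)

module _ (B : Block) (X : SC) where
  private
    Ψ = B ∷ X

  firstCut-≥ : 1 ≤ firstCut Ψ
  firstCut-≥ = search-≥ (cut? Ψ) 1 (length X)

  firstCut-≤ : firstCut Ψ ≤ length Ψ
  firstCut-≤ = search-≤ (cut? Ψ) 1 (length X)

  firstCut-cut : Cut Ψ (firstCut Ψ)
  firstCut-cut = search-holds (cut? Ψ) 1 (length X) (Cut-length Ψ)

  firstCut-minimal : ∀ j → 1 ≤ j → j < firstCut Ψ → ¬ Cut Ψ j
  firstCut-minimal = search-minimal (cut? Ψ) 1 (length X)

bars : List SC → SC
bars [] = []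
bars (A ∷ u) = bar (size A) A (bars u)

totalSize : List SC → ℕ
totalSize [] = 0
totalSize (A ∷ u) = size A + totalSize u

totalLength : List SC → ℕ
totalLength [] = 0
totalLength (A ∷ u) = length A + totalLength u

bars-setComp : ∀ {u} → All Atomic u → IsSetComp (totalSize u) (bars u)
bars-setComp [] = [] , [] , ↭-refl
bars-setComp (at ∷ ats) = bar-setComp (atomic-setComp at) (bars-setComp ats)

length-bar : ∀ m (A J : SC) → length (bar m A J) ≡ length A + length J
length-bar m A J = trans (List.length-++ A) (cong (length A +_) (List.length-map (map (_+ m)) J))

Cut-bar-length : ∀ {m k A J} → IsSetComp m A → IsSetComp k J → Cut (bar m A J) (length A)
Cut-bar-length {m} {k} {A} {J} scA scJ =
  subst (Cut (bar m A J)) (ℕ.+-identityʳ (length A)) (Cut-bar 0 scA scJ (Cut-zero J))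

size-nonEmpty : ∀ (X : SC) → All NonEmpty X → X ≢ [] → 1 ≤ size X
size-nonEmpty [] _ X≢[] = ⊥-elim (X≢[] refl)
size-nonEmpty ([] ∷ X) (ne ∷ _) _ = ⊥-elim (ne refl)
size-nonEmpty ((x ∷ B) ∷ X) _ _ = s≤s z≤n

nonEmpty⇒length≥1 : ∀ (X : SC) → X ≢ [] → 1 ≤ length X
nonEmpty⇒length≥1 [] X≢[] = ⊥-elim (X≢[] refl)
nonEmpty⇒length≥1 (_ ∷ _) _ = s≤s z≤n

firstCut-atomic : ∀ {n B X} → IsSetComp n (B ∷ X) → Atomic (take (firstCut (B ∷ X)) (B ∷ X))
firstCut-atomic {n} {B} {X} sc =
  m , left-setComp , 1≤m , λ (m′ , k′ , Ψ₁ , Γ₁ , sc₁ , sc₂ , Ψ₁≢[] , Γ₁≢[] , C≡) →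
    firstCut-minimal B X (length Ψ₁) (nonEmpty⇒length≥1 Ψ₁ Ψ₁≢[]) (inner Ψ₁ Γ₁ Γ₁≢[] C≡)
      (Cut-take⇒Cut (length Ψ₁) k Ψ (ℕ.<⇒≤ (inner Ψ₁ Γ₁ Γ₁≢[] C≡))
        (subst (λ Z → Cut Z (length Ψ₁)) (sym C≡) (Cut-bar-length sc₁ sc₂)) (firstCut-cut B X))
  where
  Ψ = B ∷ X
  k = firstCut Ψ
  C = take k Ψ
  open Decomposition (cut⇒decomposition sc {k} (firstCut-cut B X))
  1≤m : 1 ≤ m
  1≤m = subst (1 ≤_) (SetComp.size≡ left-setComp)
    (size-nonEmpty C (SetComp.nonEmpty left-setComp) (take-nonEmpty Ψ (firstCut-≥ B X) (firstCut-≤ B X) λ ()))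
  inner : ∀ {m′} Ψ₁ Γ₁ → Γ₁ ≢ [] → C ≡ bar m′ Ψ₁ Γ₁ → length Ψ₁ < k
  inner {m′} Ψ₁ Γ₁ Γ₁≢[] C≡ = subst (length Ψ₁ <_)
    (trans (sym (length-bar m′ Ψ₁ Γ₁)) (trans (cong length (sym C≡)) (length-take-≤ k Ψ (firstCut-≤ B X))))
    (subst (_≤ length Ψ₁ + length Γ₁) (ℕ.+-comm (length Ψ₁) 1) (ℕ.+-monoʳ-≤ (length Ψ₁) (nonEmpty⇒length≥1 Γ₁ Γ₁≢[])))

atomic-factorization : ∀ r {n Ψ} → length Ψ ≤ r → IsSetComp n Ψ → ∃ λ u → All Atomic u × Ψ ≡ bars u
atomic-factorization r {Ψ = []} _ _ = [] , [] , refl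
atomic-factorization (suc r) {n} {Ψ@(B ∷ X)} (s≤s len≤r) sc =
  extend (atomic-factorization r (ℕ.≤-trans shorter len≤r) right-setComp)
  where
  open Decomposition (cut⇒decomposition sc {firstCut Ψ} (firstCut-cut B X))
  shorter : length right ≤ length X
  shorter = subst (_≤ length X)
    (trans (sym (List.length-drop (firstCut Ψ) Ψ)) (trans (cong length drop≡shift) (List.length-map (map (_+ m)) right)))
    (ℕ.∸-monoʳ-≤ (suc (length X)) (firstCut-≥ B X))
  extend : (∃ λ u → All Atomic u × right ≡ bars u) → ∃ λ u → All Atomic u × Ψ ≡ bars u
  extend (u , ats , right≡) = take (firstCut Ψ) Ψ ∷ u , firstCut-atomic sc ∷ ats ,
    trans ≡bar (cong₂ (λ i Z → bar i (take (firstCut Ψ) Ψ) Z) (sym (SetComp.size≡ left-setComp)) right≡)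

-- Chunks u Ψ is the relation T (checkFactors u Ψ) from the definition of ≤#, as an inductive family.

data Chunks : List SC → SC → Set where
  [] : Chunks [] []
  _∷_ : ∀ {A u Ψ} → st (take (length A) Ψ) ≡ A → Chunks u (drop (length A) Ψ) → Chunks (A ∷ u) Ψ

checkFactors⇒Chunks : ∀ u Ψ → T (checkFactors u Ψ) → Chunks u Ψ
checkFactors⇒Chunks [] [] _ = []
checkFactors⇒Chunks (A ∷ u) Ψ t with Equivalence.to T-∧ t
... | st≡ , rest = toWitness st≡ ∷ checkFactors⇒Chunks u (drop (length A) Ψ) rest

Chunks⇒checkFactors : ∀ {u Ψ} → Chunks u Ψ → T (checkFactors u Ψ)
Chunks⇒checkFactors [] = tt
Chunks⇒checkFactors (st≡ ∷ ch) = Equivalence.from T-∧ (fromWitness st≡ , Chunks⇒checkFactors ch)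

Chunks-length : ∀ {u Ψ} → Chunks u Ψ → length Ψ ≡ totalLength u
Chunks-length [] = refl
Chunks-length {A ∷ u} {Ψ} (st≡ ∷ ch) = begin
  length Ψ                                              ≡⟨ cong length (sym (List.take++drop≡id (length A) Ψ)) ⟩
  length (take (length A) Ψ ++ drop (length A) Ψ)       ≡⟨ List.length-++ (take (length A) Ψ) ⟩
  length (take (length A) Ψ) + length (drop (length A) Ψ) ≡⟨ cong₂ _+_ take≡ (Chunks-length ch) ⟩
  length A + totalLength u                              ∎
  where
  open ≡-Reasoning
  take≡ : length (take (length A) Ψ) ≡ length A
  take≡ = trans (sym (List.length-map (map _) (take (length A) Ψ))) (cong length st≡)

Chunks-relabel : ∀ f {u} X → MonotoneOn f (concat X) → Chunks u X ⇔ Chunks u (relabel f X)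
Chunks-relabel f X mono = mk⇔ (to X mono) (from X mono)
  where
  to : ∀ {u} X → MonotoneOn f (concat X) → Chunks u X → Chunks u (relabel f X)
  to [] _ [] = []
  to X mono (_∷_ {A} st≡ ch) =
    trans (cong st (List.take-map (length A) X))
      (trans (st-relabel f (take (length A) X) (MonotoneOn-⊆ mono (∈-take⇒∈ (length A) X))) st≡)
    ∷ subst (Chunks _) (sym (List.drop-map (length A) X)) (to (drop (length A) X) (MonotoneOn-⊆ mono (∈-drop⇒∈ (length A) X)) ch)
  from : ∀ {u} X → MonotoneOn f (concat X) → Chunks u (relabel f X) → Chunks u X
  from [] _ [] = []
  from X mono (_∷_ {A} st≡ ch) =
    trans (sym (st-relabel f (take (length A) X) (MonotoneOn-⊆ mono (∈-take⇒∈ (length A) X))))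
      (trans (cong st (sym (List.take-map (length A) X))) st≡)
    ∷ from (drop (length A) X) (MonotoneOn-⊆ mono (∈-drop⇒∈ (length A) X)) (subst (Chunks _) (List.drop-map (length A) X) ch)

bars-Chunks : ∀ {u} → All Atomic u → Chunks u (bars u)
bars-Chunks [] = []
bars-Chunks {A ∷ u} (at ∷ ats) =
  trans (cong st (take-++-length A (shift (size A) (bars u)))) (st-setComp (atomic-setComp at))
  ∷ subst (Chunks u) (sym (drop-++-length A (shift (size A) (bars u))))
      (Equivalence.to (Chunks-relabel (_+ size A) (bars u) (+-monotoneOn (size A) _)) (bars-Chunks ats))

boundaries : List SC → List ℕ
boundaries [] = []
boundaries (A ∷ u) = length A ∷ map (length A +_) (boundaries u)

length-boundaries : ∀ u → length (boundaries u) ≡ length u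
length-boundaries [] = refl
length-boundaries (A ∷ u) = cong suc (trans (List.length-map (length A +_) (boundaries u)) (length-boundaries u))

∈-boundaries⁻ : ∀ {A u b} → b ∈ boundaries (A ∷ u) → b ≡ length A ⊎ ∃ λ b′ → b′ ∈ boundaries u × b ≡ length A + b′
∈-boundaries⁻ (here b≡) = inj₁ b≡
∈-boundaries⁻ {A} (there b∈) = inj₂ (∈.∈-map⁻ (length A +_) b∈)

boundaries-bounded : ∀ {u b} → All Atomic u → b ∈ boundaries u → 1 ≤ b × b ≤ totalLength u
boundaries-bounded {A ∷ u} (at ∷ ats) b∈ with ∈-boundaries⁻ {A} {u} b∈
... | inj₁ refl = atomic-length at , ℕ.m≤m+n (length A) (totalLength u)
... | inj₂ (b′ , b′∈ , refl) with boundaries-bounded ats b′∈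
...   | 1≤b′ , b′≤ = ℕ.≤-trans 1≤b′ (ℕ.m≤n+m b′ (length A)) , ℕ.+-monoʳ-≤ (length A) b′≤

boundaries-increasing : ∀ {u} → All Atomic u → AllPairs _<_ (boundaries u)
boundaries-increasing [] = []
boundaries-increasing {A ∷ u} (at ∷ ats) =
  All.map⁺ (All.tabulate λ {b} b∈ → subst (_≤ length A + b) (ℕ.+-comm (length A) 1)
    (ℕ.+-monoʳ-≤ (length A) (proj₁ (boundaries-bounded ats b∈))))
  ∷ AllPairs.map⁺ (AllPairs.map (ℕ.+-monoʳ-< (length A)) (boundaries-increasing ats))

cut⇒boundary : ∀ {u Ψ k} → All Atomic u → Chunks u Ψ → 1 ≤ k → k ≤ length Ψ → Cut Ψ k → k ∈ boundaries u
cut⇒boundary {[]} {Ψ} [] [] 1≤k k≤0 _ = ⊥-elim (ℕ.<-irrefl refl (ℕ.<-≤-trans 1≤k k≤0))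
cut⇒boundary {A ∷ u} {Ψ} {k} (at ∷ ats) (st≡ ∷ ch) 1≤k k≤len cut with ℕ.<-cmp k (length A)
... | tri< k<A _ _ = ⊥-elim (atomic⇒¬Cut at k 1≤k k<A (subst (λ Z → Cut Z k) st≡
      (Equivalence.from (Cut-relabel (rankOf (concat C)) C k (rank-monotone (concat C)))
        (Cut-take k (length A) Ψ (ℕ.<⇒≤ k<A) cut))))
  where
  C = take (length A) Ψ
... | tri≈ _ refl _ = here refl
... | tri> _ _ A<k = there (subst (_∈ map (length A +_) (boundaries u)) k≡ (∈.∈-map⁺ (length A +_)
      (cut⇒boundary ats ch (ℕ.m<n⇒0<n∸m A<k)
        (subst (k ∸ length A ≤_) (sym (List.length-drop (length A) Ψ)) (ℕ.∸-monoˡ-≤ (length A) k≤len))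
        (Cut-drop (length A) (k ∸ length A) Ψ (subst (Cut Ψ) (sym k≡) cut)))))
  where
  k≡ : length A + (k ∸ length A) ≡ k
  k≡ = ℕ.m+[n∸m]≡n (ℕ.<⇒≤ A<k)

boundary⇒cut : ∀ {u b} → All Atomic u → b ∈ boundaries u → Cut (bars u) b
boundary⇒cut {A ∷ u} (at ∷ ats) b∈ with ∈-boundaries⁻ {A} {u} b∈
... | inj₁ refl = Cut-bar-length (atomic-setComp at) (bars-setComp ats)
... | inj₂ (b′ , b′∈ , refl) = Cut-bar b′ (atomic-setComp at) (bars-setComp ats) (boundary⇒cut ats b′∈)

boundaries-cuts⇒bars : ∀ {n Ψ u} → IsSetComp n Ψ → All Atomic u → Chunks u Ψ → (∀ {b} → b ∈ boundaries u → Cut Ψ b) → Ψ ≡ bars u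
boundaries-cuts⇒bars {Ψ = []} _ [] [] _ = refl
boundaries-cuts⇒bars {n} {Ψ} {A ∷ u} sc (at ∷ ats) (st≡ ∷ ch) cuts =
  trans ≡bar (trans (cong₂ (λ i Z → bar i (take (length A) Ψ) Z) m≡ right≡) (cong (λ Z → bar (size A) Z (bars u)) C≡))
  where
  open Decomposition (cut⇒decomposition sc {length A} (cuts (here refl)))
  C≡ : take (length A) Ψ ≡ A
  C≡ = trans (sym (st-setComp left-setComp)) st≡
  m≡ : m ≡ size A
  m≡ = trans (sym (SetComp.size≡ left-setComp)) (cong size C≡)
  right≡ : right ≡ bars u
  right≡ = boundaries-cuts⇒bars right-setComp ats
    (Equivalence.from (Chunks-relabel (_+ m) right (+-monotoneOn m _)) (subst (Chunks u) drop≡shift ch))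
    λ {b} b∈ → Equivalence.to (Cut-relabel (_+ m) right b (+-monotoneOn m _))
      (subst (λ Z → Cut Z b) drop≡shift (Cut-drop (length A) b Ψ (cuts (there (∈.∈-map⁺ (length A +_) b∈)))))

cuts : SC → List ℕ
cuts Ψ = filter (cut? Ψ) (interval 1 (length Ψ))

cutCount : SC → ℕ
cutCount Ψ = length (cuts Ψ)

cuts-unique : ∀ Ψ → Unique (cuts Ψ)
cuts-unique Ψ = AllPairs.filter⁺ (cut? Ψ) (interval-unique 1 (length Ψ))

∈-cuts⁻ : ∀ {Ψ k} → k ∈ cuts Ψ → 1 ≤ k × k ≤ length Ψ × Cut Ψ k
∈-cuts⁻ {Ψ} k∈ with ∈.∈-filter⁻ (cut? Ψ) k∈
... | k∈interval , cut with ∈-interval⁻ 1 (length Ψ) k∈interval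
...   | 1≤k , s≤s k≤len = 1≤k , k≤len , cut

∈-cuts⁺ : ∀ {Ψ k} → 1 ≤ k → k ≤ length Ψ → Cut Ψ k → k ∈ cuts Ψ
∈-cuts⁺ {Ψ} 1≤k k≤len cut = ∈.∈-filter⁺ (cut? Ψ) (∈-interval⁺ 1 (length Ψ) 1≤k (s≤s k≤len)) cut

module _ {u Ψ} (ats : All Atomic u) (ch : Chunks u Ψ) where
  private
    cuts⊆boundaries : ∀ {k} → k ∈ cuts Ψ → k ∈ boundaries u
    cuts⊆boundaries k∈ with ∈-cuts⁻ {Ψ} k∈
    ... | 1≤k , k≤len , cut = cut⇒boundary ats ch 1≤k k≤len cut

  cutCount-≤ : cutCount Ψ ≤ length u
  cutCount-≤ = subst (cutCount Ψ ≤_) (length-boundaries u)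
    (unique-⊆⇒length≤ (cuts Ψ) (boundaries u) (cuts-unique Ψ) cuts⊆boundaries)

  -- With as many cuts as letters, every chunk boundary must be a cut.
  cutCount-≡⇒bars : ∀ {n} → IsSetComp n Ψ → cutCount Ψ ≡ length u → Ψ ≡ bars u
  cutCount-≡⇒bars sc count≡ = boundaries-cuts⇒bars sc ats ch λ {b} b∈ → decidable-stable (cut? Ψ b) λ ¬cut →
    ℕ.<-irrefl (trans count≡ (sym (length-boundaries u)))
      (unique-⊂⇒length< (cuts Ψ) (boundaries u) (cuts-unique Ψ) cuts⊆boundaries b∈ λ b∈cuts → ¬cut (proj₂ (proj₂ (∈-cuts⁻ {Ψ} b∈cuts))))

cutCount-bars : ∀ {u} → All Atomic u → cutCount (bars u) ≡ length u
cutCount-bars {u} ats = ℕ.≤-antisym (cutCount-≤ ats (bars-Chunks ats))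
  (subst (_≤ cutCount (bars u)) (length-boundaries u)
    (unique-⊆⇒length≤ (boundaries u) (cuts (bars u)) (increasing⇒unique (boundaries-increasing ats)) boundary∈cuts))
  where
  boundary∈cuts : ∀ {b} → b ∈ boundaries u → b ∈ cuts (bars u)
  boundary∈cuts b∈ with boundaries-bounded ats b∈
  ... | 1≤b , b≤ = ∈-cuts⁺ 1≤b (subst (_ ≤_) (sym (Chunks-length (bars-Chunks ats))) b≤) (boundary⇒cut ats b∈)

shift-injective : ∀ m X Y → shift m X ≡ shift m Y → X ≡ Y
shift-injective m X Y eq = trans (sym (unshift X)) (trans (cong (relabel (_∸ m)) eq) (unshift Y))
  where
  unshift : ∀ Z → relabel (_∸ m) (shift m Z) ≡ Z
  unshift Z = trans (relabel-∘ (_∸ m) (_+ m) Z) (trans (relabel-cong Z (λ {x} _ → ℕ.m+n∸n≡m x m)) (relabel-id Z))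

bars-nonEmpty : ∀ {A u} → Atomic A → bars (A ∷ u) ≢ []
bars-nonEmpty {[]} at _ with atomic-length at
... | ()
bars-nonEmpty {_ ∷ _} _ ()

first-letter-≤ : ∀ {A u A′ v} → All Atomic (A ∷ u) → All Atomic (A′ ∷ v) → bars (A ∷ u) ≡ bars (A′ ∷ v) → length A′ ≤ length A
first-letter-≤ {A} {u} {A′} {v} ats@(at ∷ _) ats′ eq
  with ∈-boundaries⁻ {A′} {v} (cut⇒boundary ats′ (subst (Chunks (A′ ∷ v)) (sym eq) (bars-Chunks ats′))
         (atomic-length at) (List.length-++-≤ˡ A) (boundary⇒cut ats (here refl)))
... | inj₁ A≡A′ = ℕ.≤-reflexive (sym A≡A′)
... | inj₂ (b , _ , A≡) = subst (length A′ ≤_) (sym A≡) (ℕ.m≤m+n (length A′) b)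

bars-injective : ∀ {u v} → All Atomic u → All Atomic v → bars u ≡ bars v → u ≡ v
bars-injective {[]} {[]} _ _ _ = refl
bars-injective {[]} {A ∷ v} _ (at ∷ _) eq = ⊥-elim (bars-nonEmpty {u = v} at (sym eq))
bars-injective {A ∷ u} {[]} (at ∷ _) _ eq = ⊥-elim (bars-nonEmpty {u = u} at eq)
bars-injective {A ∷ u} {A′ ∷ v} ats@(_ ∷ ats₁) ats′@(_ ∷ ats₁′) eq = cong₂ _∷_ A≡A′ (bars-injective ats₁ ats₁′ tail≡)
  where
  len≡ : length A ≡ length A′
  len≡ = ℕ.≤-antisym (first-letter-≤ {A′} {v} ats′ ats (sym eq)) (first-letter-≤ {A} {u} ats ats′ eq)
  A≡A′ : A ≡ A′
  A≡A′ = begin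
    A                                  ≡⟨ sym (take-++-length A _) ⟩
    take (length A) (bars (A ∷ u))     ≡⟨ cong₂ take len≡ eq ⟩
    take (length A′) (bars (A′ ∷ v))   ≡⟨ take-++-length A′ _ ⟩
    A′                                 ∎
    where open ≡-Reasoning
  tail≡ : bars u ≡ bars v
  tail≡ = shift-injective (size A) (bars u) (bars v) (begin
    shift (size A) (bars u)              ≡⟨ sym (drop-++-length A _) ⟩
    drop (length A) (bars (A ∷ u))       ≡⟨ cong₂ drop len≡ eq ⟩
    drop (length A′) (bars (A′ ∷ v))     ≡⟨ drop-++-length A′ _ ⟩
    shift (size A′) (bars v)             ≡⟨ cong (λ Z → shift (size Z) (bars v)) (sym A≡A′) ⟩
    shift (size A) (bars v)              ∎)
    where open ≡-Reasoning

extensions : ℕ → SC → List SC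
extensions x Φ = addToBlocks x Φ ++ insertSingleton x Φ

record Extension (x : ℕ) (Φ₀ Φ : SC) : Set where
  field
    perm : concat Φ ↭ x ∷ concat Φ₀
    nonEmpty : All NonEmpty Φ₀ → All NonEmpty Φ
    increasing : All (Linked _<_) Φ₀ → All (_< x) (concat Φ₀) → All (Linked _<_) Φ

snoc-increasing : ∀ B x → Linked _<_ B → All (_< x) B → Linked _<_ (B ++ x ∷ [])
snoc-increasing [] x _ _ = [-]
snoc-increasing (b ∷ []) x _ (b<x ∷ _) = b<x ∷ [-]
snoc-increasing (b ∷ c ∷ B) x (b<c ∷ inc) (_ ∷ below) = b<c ∷ snoc-increasing (c ∷ B) x inc below

snoc-↭ : ∀ (B : List ℕ) x R → (B ++ x ∷ []) ++ R ↭ x ∷ B ++ R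
snoc-↭ B x R = subst (_↭ x ∷ B ++ R) (sym (List.++-assoc B (x ∷ []) R)) (↭.shift x B R)

Extension-∷ : ∀ {x Φ₀ Φ} B → Extension x Φ₀ Φ → Extension x (B ∷ Φ₀) (B ∷ Φ)
Extension-∷ {x} {Φ₀} B e = record
  { perm = ↭-trans (↭.++⁺ˡ B perm) (↭.shift x B (concat Φ₀))
  ; nonEmpty = λ { (ne ∷ nes) → ne ∷ nonEmpty nes }
  ; increasing = λ { (inc ∷ incs) below → inc ∷ increasing incs (All.++⁻ʳ B below) } }
  where open Extension e

addToBlocks-extension : ∀ x Φ₀ {Φ} → Φ ∈ addToBlocks x Φ₀ → Extension x Φ₀ Φ
addToBlocks-extension x (B ∷ Bs) (here refl) = record
  { perm = snoc-↭ B x (concat Bs)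
  ; nonEmpty = λ { (_ ∷ nes) → snoc-nonEmpty B ∷ nes }
  ; increasing = λ { (inc ∷ incs) below → snoc-increasing B x inc (All.++⁻ˡ B below) ∷ incs } }
  where
  snoc-nonEmpty : ∀ (B : List ℕ) → NonEmpty (B ++ x ∷ [])
  snoc-nonEmpty [] ()
  snoc-nonEmpty (_ ∷ _) ()
addToBlocks-extension x (B ∷ Bs) (there Φ∈) with ∈.∈-map⁻ (B ∷_) Φ∈
... | _ , Φ′∈ , refl = Extension-∷ B (addToBlocks-extension x Bs Φ′∈)

insertSingleton-extension : ∀ x Φ₀ {Φ} → Φ ∈ insertSingleton x Φ₀ → Extension x Φ₀ Φ
insertSingleton-extension x [] (here refl) =
  record { perm = ↭-refl ; nonEmpty = λ _ → (λ ()) ∷ [] ; increasing = λ _ _ → [-] ∷ [] }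
insertSingleton-extension x (B ∷ Bs) (here refl) =
  record { perm = ↭-refl ; nonEmpty = (λ ()) ∷_ ; increasing = λ incs _ → [-] ∷ incs }
insertSingleton-extension x (B ∷ Bs) (there Φ∈) with ∈.∈-map⁻ (B ∷_) Φ∈
... | _ , Φ′∈ , refl = Extension-∷ B (insertSingleton-extension x Bs Φ′∈)

range-suc : ∀ n → range (suc n) ↭ suc n ∷ range n
range-suc n = subst₂ (λ a b → a ↭ suc n ∷ b) (sym (range≡interval (suc n))) (sym (range≡interval n))
  (subst (_↭ suc n ∷ interval 1 n) (trans (sym (interval-++ 1 n 1)) (cong (interval 1) (ℕ.+-comm n 1)))
    (↭-sym (↭.∷↭∷ʳ (suc n) (interval 1 n))))

setComps-sound : ∀ n {Φ} → Φ ∈ setComps n → IsSetComp n Φ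
setComps-sound zero (here refl) = [] , [] , ↭-refl
setComps-sound (suc n) Φ∈ with find (∈.∈-concatMap⁻ (extensions (suc n)) {xs = setComps n} Φ∈)
... | Φ₀ , Φ₀∈ , Φ∈ext =
  nonEmpty Φ₀.nonEmpty , increasing Φ₀.increasing (All.tabulate (s≤s ∘ proj₂ ∘ Φ₀.∈⇒bounded)) ,
  ↭-trans perm (↭-trans (prep (suc n) (proj₂ (proj₂ sc₀))) (↭-sym (range-suc n)))
  where
  sc₀ = setComps-sound n Φ₀∈
  module Φ₀ = SetComp sc₀
  open Extension ([ addToBlocks-extension (suc n) Φ₀ , insertSingleton-extension (suc n) Φ₀ ]′ (∈.∈-++⁻ (addToBlocks (suc n) Φ₀) Φ∈ext))

record Removal (x : ℕ) (Φ : SC) : Set where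
  field
    Φ₀ : SC
    Φ∈ : Φ ∈ extensions x Φ₀
    perm : x ∷ concat Φ₀ ↭ concat Φ
    nonEmpty : All NonEmpty Φ₀
    increasing : All (Linked _<_) Φ₀

last-of-increasing : ∀ B x → Linked _<_ B → All (_≤ x) B → x ∈ B → ∃ λ B₀ → B ≡ B₀ ++ x ∷ []
last-of-increasing (b ∷ []) x _ _ (here refl) = [] , refl
last-of-increasing (b ∷ c ∷ B) x (b<c ∷ _) (_ ∷ c≤x ∷ _) (here refl) = ⊥-elim (ℕ.<-irrefl refl (ℕ.<-≤-trans b<c c≤x))
last-of-increasing (b ∷ c ∷ B) x (_ ∷ inc) (_ ∷ below) (there x∈) with last-of-increasing (c ∷ B) x inc below x∈
... | B₀ , eq = b ∷ B₀ , cong (b ∷_) eq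

init-increasing : ∀ B C → Linked _<_ (B ++ C) → Linked _<_ B
init-increasing [] C _ = []
init-increasing (b ∷ []) C _ = [-]
init-increasing (b ∷ c ∷ B) C (b<c ∷ inc) = b<c ∷ init-increasing (c ∷ B) C inc

remove-max : ∀ x Φ → x ∈ concat Φ → All (_≤ x) (concat Φ) → All NonEmpty Φ → All (Linked _<_) Φ → Removal x Φ
remove-max x (B ∷ Bs) x∈ below (ne ∷ nes) (inc ∷ incs) with ∈.∈-++⁻ B x∈
... | inj₁ x∈B with last-of-increasing B x inc (All.++⁻ˡ B below) x∈B
...   | [] , refl = record
        { Φ₀ = Bs ; Φ∈ = ∈.∈-++⁺ʳ (addToBlocks x Bs) (singleton-first Bs) ; perm = ↭-refl ; nonEmpty = nes ; increasing = incs }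
  where
  singleton-first : ∀ Bs → ((x ∷ []) ∷ Bs) ∈ insertSingleton x Bs
  singleton-first [] = here refl
  singleton-first (_ ∷ _) = here refl
...   | B₀@(_ ∷ _) , refl = record
        { Φ₀ = B₀ ∷ Bs ; Φ∈ = ∈.∈-++⁺ˡ {xs = addToBlocks x (B₀ ∷ Bs)} (here refl)
        ; perm = ↭-sym (snoc-↭ B₀ x (concat Bs)) ; nonEmpty = (λ ()) ∷ nes ; increasing = init-increasing B₀ (x ∷ []) inc ∷ incs }
remove-max x (B ∷ Bs) x∈ below (ne ∷ nes) (inc ∷ incs) | inj₂ x∈Bs = record
  { Φ₀ = B ∷ Φ₀
  ; Φ∈ = [ (λ Φ∈ → ∈.∈-++⁺ˡ (there (∈.∈-map⁺ (B ∷_) Φ∈))) , (λ Φ∈ → ∈.∈-++⁺ʳ (addToBlocks x (B ∷ Φ₀)) (there (∈.∈-map⁺ (B ∷_) Φ∈))) ]′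
      (∈.∈-++⁻ (addToBlocks x Φ₀) Φ∈)
  ; perm = ↭-trans (↭-sym (↭.shift x B (concat Φ₀))) (↭.++⁺ˡ B perm)
  ; nonEmpty = ne ∷ nonEmpty ; increasing = inc ∷ increasing }
  where open Removal (remove-max x Bs x∈Bs (All.++⁻ʳ B below) nes incs)

setComps-complete : ∀ n {Φ} → IsSetComp n Φ → Φ ∈ setComps n
setComps-complete zero {Φ} sc with empty (SetComp.nonEmpty sc) (↭.↭-empty-inv (proj₂ (proj₂ sc)))
  where
  empty : ∀ {Φ} → All NonEmpty Φ → concat Φ ≡ [] → Φ ≡ []
  empty {[]} _ _ = refl
  empty {[] ∷ _} (ne ∷ _) _ = ⊥-elim (ne refl)
  empty {(_ ∷ _) ∷ _} _ ()
... | refl = here refl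
setComps-complete (suc n) {Φ} sc =
  ∈.∈-concatMap⁺ (extensions (suc n)) {xs = setComps n} (lose (setComps-complete n sc₀) Φ∈)
  where
  module Φ = SetComp sc
  open Removal (remove-max (suc n) Φ (Φ.bounded⇒∈ (s≤s z≤n) ℕ.≤-refl) (All.tabulate (proj₂ ∘ Φ.∈⇒bounded)) Φ.nonEmpty Φ.increasing)
  sc₀ : IsSetComp n Φ₀
  sc₀ = nonEmpty , increasing , ↭.drop-∷ (↭-trans perm (↭-trans (proj₂ (proj₂ sc)) (range-suc n)))

if-≡ᵇ-yes : ∀ {X : Set} {a b} {x y : X} → a ≡ b → (if a ≡ᵇ b then x else y) ≡ x
if-≡ᵇ-yes {a = a} {b} a≡b with a ≡ᵇ b in eq
... | true = refl
... | false = ⊥-elim (subst T eq (ℕ.≡⇒≡ᵇ a b a≡b))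

if-≡ᵇ-no : ∀ {X : Set} {a b} {x y : X} → a ≢ b → (if a ≡ᵇ b then x else y) ≡ y
if-≡ᵇ-no {a = a} {b} a≢b with a ≡ᵇ b in eq
... | true = ⊥-elim (a≢b (ℕ.≡ᵇ⇒≡ a b (subst T (sym eq) tt)))
... | false = refl

concat-snoc : ∀ (acc : SC) B → concat (acc ++ B ∷ []) ≡ concat acc ++ B
concat-snoc acc B = trans (sym (List.concat-++ acc (B ∷ []))) (cong (concat acc ++_) (List.++-identityʳ B))

size-snoc : ∀ (acc : SC) B → size acc + length B ≡ size (acc ++ B ∷ [])
size-snoc acc B = trans (sym (List.length-++ (concat acc))) (cong length (sym (concat-snoc acc B)))

maxL-snoc : ∀ (acc : SC) B → maxL (concat acc) ⊔ maxL B ≡ maxL (concat (acc ++ B ∷ []))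
maxL-snoc acc B = trans (sym (maxL-++ (concat acc) B)) (cong maxL (sym (concat-snoc acc B)))

-- factorsGo acc cnt mx Bs keeps cnt = size acc and mx = max entry of acc.
factorsGo-last : ∀ acc Bs cnt mx → cnt ≡ size acc → mx ≡ maxL (concat acc) → Bs ≢ [] →
  (∀ j → 1 ≤ j → j < length Bs → maxL (concat (acc ++ take j Bs)) ≢ size (acc ++ take j Bs)) →
  maxL (concat (acc ++ Bs)) ≡ size (acc ++ Bs) → factorsGo acc cnt mx Bs ≡ st (acc ++ Bs) ∷ []
factorsGo-last acc [] cnt mx _ _ Bs≢[] _ _ = ⊥-elim (Bs≢[] refl)
factorsGo-last acc (B ∷ []) cnt mx refl refl _ _ closed =
  if-≡ᵇ-yes (trans (maxL-snoc acc B) (trans closed (sym (size-snoc acc B))))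
factorsGo-last acc (B ∷ B′ ∷ Bs) cnt mx refl refl _ open′ closed =
  trans (if-≡ᵇ-no λ eq → open′ 1 (s≤s z≤n) (s≤s (s≤s z≤n)) (trans (sym (maxL-snoc acc B)) (trans eq (size-snoc acc B))))
    (trans (factorsGo-last (acc ++ B ∷ []) (B′ ∷ Bs) _ _ (size-snoc acc B) (maxL-snoc acc B) (λ ())
       (λ j 1≤j j< → subst (λ Z → maxL (concat Z) ≢ size Z) (sym (List.++-assoc acc (B ∷ []) (take j (B′ ∷ Bs))))
          (open′ (suc j) (s≤s z≤n) (s≤s j<)))
       (subst (λ Z → maxL (concat Z) ≡ size Z) (sym (List.++-assoc acc (B ∷ []) (B′ ∷ Bs))) closed))
      (cong (λ Z → st Z ∷ []) (List.++-assoc acc (B ∷ []) (B′ ∷ Bs))))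

-- A later entry y ≤ |xs| would make y ∷ xs a list of |xs| + 1 distinct elements of [|xs|].
closed-prefix⇒Cut : ∀ {n Ψ} j → IsSetComp n Ψ → maxL (concat (take j Ψ)) ≡ size (take j Ψ) → Cut Ψ j
closed-prefix⇒Cut {n} {Ψ} j sc closed {x} {y} x∈ y∈ = separate (y ≤? length xs)
  where
  module Ψ = SetComp sc
  xs = concat (take j Ψ)
  U : Unique (xs ++ concat (drop j Ψ))
  U = subst Unique (sym (concat-take++drop j Ψ)) Ψ.unique
  y∉xs : All (y ≢_) xs
  y∉xs = All.tabulate λ z∈ y≡z → Unique-++⇒disjoint xs U z∈ (subst (_∈ _) y≡z y∈)
  within : y ≤ length xs → ∀ {z} → z ∈ y ∷ xs → z ∈ interval 1 (length xs)
  within y≤ (here refl) = ∈-interval⁺ 1 (length xs) (proj₁ (Ψ.∈⇒bounded (∈-drop⇒∈ j Ψ y∈))) (s≤s y≤)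
  within _ (there z∈) = ∈-interval⁺ 1 (length xs) (proj₁ (Ψ.∈⇒bounded (∈-take⇒∈ j Ψ z∈)))
    (s≤s (subst (_ ≤_) closed (≤-maxL xs z∈)))
  separate : Dec (y ≤ length xs) → x < y
  separate (no y≰) = ℕ.≤-<-trans (subst (x ≤_) closed (≤-maxL xs x∈)) (ℕ.≰⇒> y≰)
  separate (yes y≤) = ⊥-elim (ℕ.<-irrefl refl (subst (length xs <_) (length-interval 1 (length xs))
    (unique-⊆⇒length≤ (y ∷ xs) (interval 1 (length xs)) (y∉xs ∷ Unique-++⁻ˡ xs U) (within y≤))))

factors-atomic : ∀ {A} → Atomic A → factors A ≡ A ∷ []
factors-atomic {A} at = trans
  (factorsGo-last [] A 0 0 refl refl (λ { refl → ℕ.<-irrefl refl (atomic-length at) }) open′ closed)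
  (cong (_∷ []) (st-setComp sc))
  where
  sc = atomic-setComp at
  module A = SetComp sc
  closed : maxL (concat A) ≡ size A
  closed = ℕ.≤-antisym (maxL-least (concat A) (proj₂ ∘ A.∈⇒bounded)) (≤-maxL (concat A) (A.bounded⇒∈ (atomic-size at) ℕ.≤-refl))
  open′ : ∀ j → 1 ≤ j → j < length A → maxL (concat (take j A)) ≢ size (take j A)
  open′ j 1≤j j<len closed′ = atomic⇒¬Cut at j 1≤j j<len (closed-prefix⇒Cut j sc closed′)

module _ {A : SC} (at : Atomic A) where

  V-term : ∀ {p} → p ∈ V A → proj₁ p ≡ 1ℚ × IsSetComp (size A) (proj₂ p) × Chunks (A ∷ []) (proj₂ p)
  V-term p∈ with ∈.∈-map⁻ (λ Ψ → (1ℚ , Ψ)) p∈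
  ... | Ψ , Ψ∈ , refl with ∈.∈-filter⁻ (λ Ψ → T? (A ≤# Ψ)) {xs = setComps (size A)} Ψ∈
  ...   | Ψ∈setComps , A≤#Ψ = refl , setComps-sound (size A) Ψ∈setComps ,
          checkFactors⇒Chunks (A ∷ []) Ψ (subst (λ F → T (checkFactors F Ψ)) (factors-atomic at) (proj₂ (Equivalence.to T-∧ A≤#Ψ)))

  V-self : (1ℚ , A) ∈ V A
  V-self = ∈.∈-map⁺ (λ Ψ → (1ℚ , Ψ)) (∈.∈-filter⁺ (λ Ψ → T? (A ≤# Ψ)) (setComps-complete (size A) (atomic-setComp at))
    (Equivalence.from T-∧ (fromWitness refl ,
      subst (λ F → T (checkFactors F A)) (sym (factors-atomic at))
        (Chunks⇒checkFactors (trans (cong st (List.take-all (length A) A ℕ.≤-refl)) (st-setComp (atomic-setComp at))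
          ∷ subst (Chunks []) (sym (List.drop-all (length A) A ℕ.≤-refl)) [])))))

-- The shuffle product W_Φ W_Ψ

subsets-length : ∀ k L {S} → S ∈ subsets k L → length S ≡ k
subsets-length zero L (here refl) = refl
subsets-length (suc k) (x ∷ L) S∈ with ∈.∈-++⁻ (map (x ∷_) (subsets k L)) S∈
... | inj₁ S∈₁ with ∈.∈-map⁻ (x ∷_) S∈₁
...   | S′ , S′∈ , refl = cong suc (subsets-length k L S′∈)
subsets-length (suc k) (x ∷ L) S∈ | inj₂ S∈₂ = subsets-length (suc k) L S∈₂

subsets-⊆ : ∀ k L {S} → S ∈ subsets k L → ∀ {z} → z ∈ S → z ∈ L
subsets-⊆ zero L (here refl) ()
subsets-⊆ (suc k) (x ∷ L) S∈ z∈ with ∈.∈-++⁻ (map (x ∷_) (subsets k L)) S∈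
... | inj₁ S∈₁ with ∈.∈-map⁻ (x ∷_) S∈₁
...   | S′ , S′∈ , refl with z∈
...     | here z≡x = here z≡x
...     | there z∈S′ = there (subsets-⊆ k L S′∈ z∈S′)
subsets-⊆ (suc k) (x ∷ L) S∈ z∈ | inj₂ S∈₂ = there (subsets-⊆ (suc k) L S∈₂ z∈)

subsets-increasing : ∀ k L {S} → AllPairs _<_ L → S ∈ subsets k L → AllPairs _<_ S
subsets-increasing zero L _ (here refl) = []
subsets-increasing (suc k) (x ∷ L) (x< ∷ inc) S∈ with ∈.∈-++⁻ (map (x ∷_) (subsets k L)) S∈
... | inj₁ S∈₁ with ∈.∈-map⁻ (x ∷_) S∈₁
...   | S′ , S′∈ , refl = All.tabulate (All.lookup x< ∘ subsets-⊆ k L S′∈) ∷ subsets-increasing k L inc S′∈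
subsets-increasing (suc k) (x ∷ L) (_ ∷ inc) S∈ | inj₂ S∈₂ = subsets-increasing (suc k) L inc S∈₂

filter-cong-∈ : ∀ {P Q : ℕ → Set} (P? : ∀ x → Dec (P x)) (Q? : ∀ x → Dec (Q x)) L →
  (∀ {z} → z ∈ L → P z ⇔ Q z) → filter P? L ≡ filter Q? L
filter-cong-∈ P? Q? [] _ = refl
filter-cong-∈ P? Q? (x ∷ L) P⇔Q with P? x | Q? x
... | yes _ | yes _ = cong (x ∷_) (filter-cong-∈ P? Q? L (P⇔Q ∘ there))
... | no _ | no _ = filter-cong-∈ P? Q? L (P⇔Q ∘ there)
... | yes p | no ¬q = ⊥-elim (¬q (Equivalence.to (P⇔Q (here refl)) p))
... | no ¬p | yes q = ⊥-elim (¬p (Equivalence.from (P⇔Q (here refl)) q))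

complement : List ℕ → List ℕ → List ℕ
complement S L = filter (_∉? S) L

subsets-↭ : ∀ k L {S} → Unique L → S ∈ subsets k L → S ++ complement S L ↭ L
subsets-↭ zero L u (here refl) = subst (_↭ L) (sym (List.filter-all (_∉? []) (All.tabulate λ _ ()))) ↭-refl
subsets-↭ (suc k) (x ∷ L) u S∈ with ∈.∈-++⁻ (map (x ∷_) (subsets k L)) S∈
... | inj₁ S∈₁ with ∈.∈-map⁻ (x ∷_) S∈₁
...   | S′ , S′∈ , refl = prep x (subst (λ Z → S′ ++ Z ↭ L) (sym complement≡) (subsets-↭ k L (AllPairs.tail u) S′∈))
  where
  complement≡ : complement (x ∷ S′) (x ∷ L) ≡ complement S′ L
  complement≡ = trans (List.filter-reject (_∉? x ∷ S′) (λ x∉ → x∉ (here refl)))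
    (filter-cong-∈ (_∉? x ∷ S′) (_∉? S′) L λ z∈ → mk⇔ (λ z∉ → z∉ ∘ there)
      λ { z∉ (here refl) → Unique[x∷xs]⇒x∉xs u z∈ ; z∉ (there z∈S′) → z∉ z∈S′ })
subsets-↭ (suc k) (x ∷ L) {S} u S∈ | inj₂ S∈₂ =
  subst (λ Z → S ++ Z ↭ x ∷ L) (sym (List.filter-accept (_∉? S) (Unique[x∷xs]⇒x∉xs u ∘ subsets-⊆ (suc k) L S∈₂)))
    (↭-trans (↭.shift x S _) (prep x (subsets-↭ (suc k) L (AllPairs.tail u) S∈₂)))

take-∈-subsets : ∀ k (L : List ℕ) → k ≤ length L → take k L ∈ subsets k L
take-∈-subsets zero L _ = here refl
take-∈-subsets (suc k) (x ∷ L) (s≤s k≤) = ∈.∈-++⁺ˡ (∈.∈-map⁺ (x ∷_) (take-∈-subsets k L k≤))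

nth-∈ : ∀ S j → j < length S → nth S j ∈ S
nth-∈ (s ∷ S) zero _ = here refl
nth-∈ (s ∷ S) (suc j) (s≤s j<) = there (nth-∈ S j j<)

nth-increasing : ∀ S i j → AllPairs _<_ S → i < j → j < length S → nth S i < nth S j
nth-increasing (s ∷ S) zero (suc j) (s< ∷ _) _ (s≤s j<) = All.lookup s< (nth-∈ S j j<)
nth-increasing (s ∷ S) (suc i) (suc j) (_ ∷ inc) (s≤s i<j) (s≤s j<) = nth-increasing S i j inc i<j j<

map-nth-interval : ∀ S a → map (λ j → nth S (j ∸ a)) (interval a (length S)) ≡ S
map-nth-interval [] a = refl
map-nth-interval (s ∷ S) a = cong₂ _∷_ (cong (nth (s ∷ S)) (ℕ.n∸n≡0 a))
  (trans (List.map-cong-local (All.tabulate λ {j} j∈ → cong (nth (s ∷ S)) (ℕ.+-∸-assoc 1 {j} {suc a} (proj₁ (∈-interval⁻ (suc a) (length S) j∈)))))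
    (map-nth-interval S (suc a)))

-- up Φ S is definitionally relabel (select S) Φ.
select : List ℕ → ℕ → ℕ
select S j = nth S (j ∸ 1)

module Relabelled {n Φ} (sc : IsSetComp n Φ) (S : List ℕ) (inc : AllPairs _<_ S) (length≡ : length S ≡ n) where
  private
    module Φ = SetComp sc

  select-monotone : MonotoneOn (select S) (concat Φ)
  select-monotone {x} {y} x∈ y∈ x<y with Φ.∈⇒bounded x∈ | Φ.∈⇒bounded y∈
  ... | 1≤x , _ | 1≤y , y≤n = nth-increasing S (x ∸ 1) (y ∸ 1) inc (ℕ.∸-monoˡ-< x<y 1≤x)
    (subst (y ∸ 1 <_) (sym length≡) (ℕ.∸-monoˡ-< {y} {1} {suc n} (s≤s y≤n) 1≤y))

  ↭S : concat (up Φ S) ↭ S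
  ↭S = subst (concat (up Φ S) ↭_) (trans (cong (λ i → map (select S) (interval 1 i)) (sym length≡)) (map-nth-interval S 1))
    (subst (_↭ map (select S) (interval 1 n)) (sym (List.concat-map Φ)) (↭.map⁺ (select S) Φ.↭interval))

  nonEmpty : All NonEmpty (up Φ S)
  nonEmpty = relabel-nonEmpty (select S) Φ Φ.nonEmpty

  increasing : All (Linked _<_) (up Φ S)
  increasing = relabel-increasing (select S) Φ select-monotone Φ.increasing

Chunks-∷-++ : ∀ {A w X Y} → Chunks (A ∷ []) X → Chunks w Y → Chunks (A ∷ w) (X ++ Y)
Chunks-∷-++ {A} {w} {X} {Y} chX@(st≡ ∷ _) chY =
  trans (cong st (trans take≡ (sym (List.take-all (length A) X (ℕ.≤-reflexive length≡))))) st≡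
  ∷ subst (Chunks w) (sym drop≡) chY
  where
  length≡ : length X ≡ length A
  length≡ = trans (Chunks-length chX) (ℕ.+-identityʳ (length A))
  take≡ : take (length A) (X ++ Y) ≡ X
  take≡ = subst (λ i → take i (X ++ Y) ≡ X) length≡ (take-++-length X Y)
  drop≡ : drop (length A) (X ++ Y) ≡ Y
  drop≡ = subst (λ i → drop i (X ++ Y) ≡ Y) length≡ (drop-++-length X Y)

module Shuffle {Φ Ψ} (scΦ : IsSetComp (size Φ) Φ) (scΨ : IsSetComp (size Ψ) Ψ) {S} (S∈ : S ∈ subsets (size Φ) (range (size Φ + size Ψ))) where
  private
    n = size Φ
    m = size Ψ
    N = range (n + m)
    S′ = complement S N
    N-increasing : AllPairs _<_ N
    N-increasing = subst (AllPairs _<_) (sym (range≡interval (n + m))) (interval-increasing 1 (n + m))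
    S-increasing : AllPairs _<_ S
    S-increasing = subsets-increasing n N N-increasing S∈
    S′-increasing : AllPairs _<_ S′
    S′-increasing = AllPairs.filter⁺ (_∉? S) N-increasing
    S++S′↭N : S ++ S′ ↭ N
    S++S′↭N = subsets-↭ n N (increasing⇒unique N-increasing) S∈
    length-S : length S ≡ n
    length-S = subsets-length n N S∈
    length-S′ : length S′ ≡ m
    length-S′ = ℕ.+-cancelˡ-≡ n _ _ (begin
      n + length S′             ≡⟨ cong (_+ length S′) (sym length-S) ⟩
      length S + length S′      ≡⟨ sym (List.length-++ S) ⟩
      length (S ++ S′)          ≡⟨ ↭.↭-length S++S′↭N ⟩
      length N                 ≡⟨ trans (cong length (range≡interval (n + m))) (length-interval 1 (n + m)) ⟩
      n + m                    ∎)
      where open ≡-Reasoning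
    module L = Relabelled scΦ S S-increasing length-S
    module R = Relabelled scΨ S′ S′-increasing length-S′

  shuffle : SC
  shuffle = up Φ S ++ up Ψ S′

  shuffle-setComp : IsSetComp (n + m) shuffle
  shuffle-setComp = All.++⁺ L.nonEmpty R.nonEmpty , All.++⁺ L.increasing R.increasing ,
    subst (_↭ N) (List.concat-++ (up Φ S) (up Ψ S′)) (↭-trans (↭.++⁺ L.↭S R.↭S) S++S′↭N)

  shuffle-Chunks : ∀ {A w} → Chunks (A ∷ []) Φ → Chunks w Ψ → Chunks (A ∷ w) shuffle
  shuffle-Chunks chΦ chΨ = Chunks-∷-++
    (Equivalence.to (Chunks-relabel (select S) Φ L.select-monotone) chΦ)
    (Equivalence.to (Chunks-relabel (select S′) Ψ R.select-monotone) chΨ)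

mulW-term : ∀ {Φ Ψ p} → IsSetComp (size Φ) Φ → IsSetComp (size Ψ) Ψ → p ∈ mulW Φ Ψ →
  proj₁ p ≡ 1ℚ × IsSetComp (size Φ + size Ψ) (proj₂ p) ×
  (∀ {A w} → Chunks (A ∷ []) Φ → Chunks w Ψ → Chunks (A ∷ w) (proj₂ p))
mulW-term {Φ} {Ψ} scΦ scΨ p∈ with ∈.∈-map⁻ _ {xs = subsets (size Φ) (range (size Φ + size Ψ))} p∈
... | S , S∈ , refl = refl , shuffle-setComp , shuffle-Chunks
  where open Shuffle scΦ scΨ S∈

-- The shuffle with S = [n] is the concatenation Φ|Ψ.
bar∈mulW : ∀ {Φ Ψ} → IsSetComp (size Φ) Φ → IsSetComp (size Ψ) Ψ → (1ℚ , bar (size Φ) Φ Ψ) ∈ mulW Φ Ψ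
bar∈mulW {Φ} {Ψ} scΦ scΨ = subst (_∈ mulW Φ Ψ) term≡ (∈.∈-map⁺ term (take-∈-subsets n N n≤))
  where
  n = size Φ
  m = size Ψ
  N = range (n + m)
  term : List ℕ → ℚ × SC
  term S = 1ℚ , up Φ S ++ up Ψ (complement S N)
  N≡ : N ≡ interval 1 n ++ interval (1 + n) m
  N≡ = trans (range≡interval (n + m)) (interval-++ 1 n m)
  n≤ : n ≤ length N
  n≤ = subst (n ≤_) (sym (trans (cong length (range≡interval (n + m))) (length-interval 1 (n + m)))) (ℕ.m≤m+n n m)
  take≡ : take n N ≡ interval 1 n
  take≡ = trans (cong (take n) N≡)
    (subst (λ l → take l (interval 1 n ++ interval (1 + n) m) ≡ interval 1 n) (length-interval 1 n) (take-++-length _ _))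
  complement≡ : complement (interval 1 n) N ≡ interval (1 + n) m
  complement≡ = trans (cong (complement (interval 1 n)) N≡)
    (trans (List.filter-++ (_∉? interval 1 n) (interval 1 n) (interval (1 + n) m))
      (cong₂ _++_ (List.filter-none (_∉? interval 1 n) (All.tabulate λ j∈ j∉ → j∉ j∈))
        (List.filter-all (_∉? interval 1 n) (All.tabulate λ j∈ j∈′ → ℕ.<-irrefl refl
          (ℕ.<-≤-trans (proj₂ (∈-interval⁻ 1 n j∈′)) (proj₁ (∈-interval⁻ (1 + n) m j∈)))))))
  select-interval : ∀ {a k j} → 1 ≤ j → j ≤ k → select (interval a k) j ≡ a + j ∸ 1
  select-interval {a} {k} {j@(suc j′)} _ j≤k = trans (nth-interval a k j′ j≤k) (sym (ℕ.+-∸-assoc a {j} (s≤s z≤n)))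
  up-left : up Φ (interval 1 n) ≡ Φ
  up-left = trans (relabel-cong Φ λ j∈ → let (1≤j , j≤n) = SetComp.∈⇒bounded scΦ j∈ in select-interval 1≤j j≤n) (relabel-id Φ)
  up-right : up Ψ (interval (1 + n) m) ≡ shift n Ψ
  up-right = relabel-cong Ψ λ {j} j∈ → let (1≤j , j≤m) = SetComp.∈⇒bounded scΨ j∈ in
    trans (select-interval 1≤j j≤m) (ℕ.+-comm n j)
  term≡ : term (take n N) ≡ (1ℚ , bar n Φ Ψ)
  term≡ = cong (1ℚ ,_) (trans (cong (λ S → up Φ S ++ up Ψ (complement S N)) take≡)
    (cong₂ _++_ up-left (trans (cong (up Ψ) complement≡) up-right)))

prodV-term : ∀ {w} → All Atomic w → ∀ {p} → p ∈ prodV w →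
  proj₁ p ≡ 1ℚ × IsSetComp (totalSize w) (proj₂ p) × Chunks w (proj₂ p)
prodV-term [] (here refl) = refl , ([] , [] , ↭-refl) , []
prodV-term {A ∷ w} (at ∷ ats) {p} p∈
  with find (∈.∈-concatMap⁻ (λ q → concatMap (λ r → scale (proj₁ q ℚ.* proj₁ r) (mulW (proj₂ q) (proj₂ r))) (prodV w)) {xs = V A} p∈)
... | q , q∈ , p∈q with find (∈.∈-concatMap⁻ (λ r → scale (proj₁ q ℚ.* proj₁ r) (mulW (proj₂ q) (proj₂ r))) {xs = prodV w} p∈q)
...   | r , r∈ , p∈qr with ∈.∈-map⁻ (λ t → (proj₁ q ℚ.* proj₁ r) ℚ.* proj₁ t , proj₂ t) p∈qr
...     | t , t∈ , refl with V-term at q∈ | prodV-term ats r∈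
...       | q≡1 , scq , chq | r≡1 , scr , chr with mulW-term (SetComp.ofSize scq) (SetComp.ofSize scr) t∈
...         | t≡1 , sct , cht =
  trans (cong₂ (λ a b → (a ℚ.* b) ℚ.* proj₁ t) q≡1 r≡1) (cong (1ℚ ℚ.*_) t≡1) ,
  subst (λ i → IsSetComp i (proj₂ t)) (cong₂ _+_ (SetComp.size≡ scq) (SetComp.size≡ scr)) sct ,
  cht chq chr

bars∈prodV : ∀ {w} → All Atomic w → (1ℚ , bars w) ∈ prodV w
bars∈prodV [] = here refl
bars∈prodV {A ∷ w} (at ∷ ats) =
  ∈.∈-concatMap⁺ (λ q → concatMap (λ r → scale (proj₁ q ℚ.* proj₁ r) (mulW (proj₂ q) (proj₂ r))) (prodV w)) {xs = V A}
    (lose (V-self at) (∈.∈-concatMap⁺ (λ r → scale (1ℚ ℚ.* proj₁ r) (mulW A (proj₂ r))) {xs = prodV w}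
      (lose (bars∈prodV ats) (∈.∈-map⁺ (λ t → (1ℚ ℚ.* 1ℚ) ℚ.* proj₁ t , proj₂ t)
        (bar∈mulW (atomic-setComp at) (SetComp.ofSize (bars-setComp ats)))))))

-- Coefficients and spanning

_≟SC_ : (Φ Ψ : SC) → Dec (Φ ≡ Ψ)
_≟SC_ = List.≡-dec (List.≡-dec _≟_)

coeff-∷-≡ : ∀ p x Φ → proj₂ p ≡ Φ → coeff (p ∷ x) Φ ≡ proj₁ p ℚ.+ coeff x Φ
coeff-∷-≡ p x Φ eq = cong (foldr ℚ._+_ 0ℚ ∘ map proj₁) (List.filter-accept (λ q → proj₂ q ≟SC Φ) eq)

coeff-∷-≢ : ∀ p x Φ → proj₂ p ≢ Φ → coeff (p ∷ x) Φ ≡ coeff x Φ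
coeff-∷-≢ p x Φ neq = cong (foldr ℚ._+_ 0ℚ ∘ map proj₁) (List.filter-reject (λ q → proj₂ q ≟SC Φ) neq)

coeff-W-≡ : ∀ Ψ → coeff (W Ψ) Ψ ≡ 1ℚ
coeff-W-≡ Ψ = trans (coeff-∷-≡ (1ℚ , Ψ) [] Ψ refl) (ℚ.+-identityʳ 1ℚ)

coeff-W-≢ : ∀ {Ψ Φ} → Ψ ≢ Φ → coeff (W Ψ) Φ ≡ 0ℚ
coeff-W-≢ {Ψ} {Φ} neq = coeff-∷-≢ (1ℚ , Ψ) [] Φ neq

coeff-++ : ∀ x y Φ → coeff (x ++ y) Φ ≡ coeff x Φ ℚ.+ coeff y Φ
coeff-++ [] y Φ = sym (ℚ.+-identityˡ (coeff y Φ))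
coeff-++ (p ∷ x) y Φ = step (proj₂ p ≟SC Φ)
  where
  step : Dec (proj₂ p ≡ Φ) → coeff (p ∷ x ++ y) Φ ≡ coeff (p ∷ x) Φ ℚ.+ coeff y Φ
  step (yes eq) = begin
    coeff (p ∷ x ++ y) Φ                           ≡⟨ coeff-∷-≡ p (x ++ y) Φ eq ⟩
    proj₁ p ℚ.+ coeff (x ++ y) Φ                   ≡⟨ cong (proj₁ p ℚ.+_) (coeff-++ x y Φ) ⟩
    proj₁ p ℚ.+ (coeff x Φ ℚ.+ coeff y Φ)          ≡⟨ sym (ℚ.+-assoc (proj₁ p) (coeff x Φ) (coeff y Φ)) ⟩
    (proj₁ p ℚ.+ coeff x Φ) ℚ.+ coeff y Φ          ≡⟨ cong (ℚ._+ coeff y Φ) (sym (coeff-∷-≡ p x Φ eq)) ⟩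
    coeff (p ∷ x) Φ ℚ.+ coeff y Φ                  ∎
    where open ≡-Reasoning
  step (no neq) = trans (coeff-∷-≢ p (x ++ y) Φ neq) (trans (coeff-++ x y Φ) (cong (ℚ._+ coeff y Φ) (sym (coeff-∷-≢ p x Φ neq))))

coeff-scale : ∀ a x Φ → coeff (scale a x) Φ ≡ a ℚ.* coeff x Φ
coeff-scale a [] Φ = sym (ℚ.*-zeroʳ a)
coeff-scale a (p ∷ x) Φ = step (proj₂ p ≟SC Φ)
  where
  step : Dec (proj₂ p ≡ Φ) → coeff (scale a (p ∷ x)) Φ ≡ a ℚ.* coeff (p ∷ x) Φ
  step (yes eq) = begin
    coeff (scale a (p ∷ x)) Φ                      ≡⟨ coeff-∷-≡ (a ℚ.* proj₁ p , proj₂ p) (scale a x) Φ eq ⟩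
    a ℚ.* proj₁ p ℚ.+ coeff (scale a x) Φ          ≡⟨ cong (a ℚ.* proj₁ p ℚ.+_) (coeff-scale a x Φ) ⟩
    a ℚ.* proj₁ p ℚ.+ a ℚ.* coeff x Φ              ≡⟨ sym (ℚ.*-distribˡ-+ a (proj₁ p) (coeff x Φ)) ⟩
    a ℚ.* (proj₁ p ℚ.+ coeff x Φ)                  ≡⟨ cong (a ℚ.*_) (sym (coeff-∷-≡ p x Φ eq)) ⟩
    a ℚ.* coeff (p ∷ x) Φ                          ∎
    where open ≡-Reasoning
  step (no neq) = trans (coeff-∷-≢ (a ℚ.* proj₁ p , proj₂ p) (scale a x) Φ neq)
    (trans (coeff-scale a x Φ) (cong (a ℚ.*_) (sym (coeff-∷-≢ p x Φ neq))))

coeff-∷ : ∀ p x Φ → coeff (p ∷ x) Φ ≡ coeff (scale (proj₁ p) (W (proj₂ p)) ++ x) Φ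
coeff-∷ p x Φ = sym (trans (coeff-++ (scale (proj₁ p) (W (proj₂ p))) x Φ)
  (trans (cong (ℚ._+ coeff x Φ) (coeff-scale (proj₁ p) (W (proj₂ p)) Φ)) (term (proj₂ p ≟SC Φ))))
  where
  term : Dec (proj₂ p ≡ Φ) → proj₁ p ℚ.* coeff (W (proj₂ p)) Φ ℚ.+ coeff x Φ ≡ coeff (p ∷ x) Φ
  term (yes refl) = trans (cong (λ c → proj₁ p ℚ.* c ℚ.+ coeff x Φ) (coeff-W-≡ Φ))
    (trans (cong (ℚ._+ coeff x Φ) (ℚ.*-identityʳ (proj₁ p))) (sym (coeff-∷-≡ p x Φ refl)))
  term (no neq) = trans (cong (λ c → proj₁ p ℚ.* c ℚ.+ coeff x Φ) (coeff-W-≢ neq))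
    (trans (cong (ℚ._+ coeff x Φ) (ℚ.*-zeroʳ (proj₁ p))) (trans (ℚ.+-identityˡ (coeff x Φ)) (sym (coeff-∷-≢ p x Φ neq))))

coeff-≢0⇒∈ : ∀ x Φ → coeff x Φ ≢ 0ℚ → ∃ λ q → (q , Φ) ∈ x
coeff-≢0⇒∈ [] Φ ≢0 = ⊥-elim (≢0 refl)
coeff-≢0⇒∈ (p ∷ x) Φ ≢0 = step (proj₂ p ≟SC Φ)
  where
  step : Dec (proj₂ p ≡ Φ) → ∃ λ q → (q , Φ) ∈ p ∷ x
  step (yes refl) = proj₁ p , here refl
  step (no neq) with coeff-≢0⇒∈ x Φ (≢0 ∘ trans (coeff-∷-≢ p x Φ neq))
  ... | q , q∈ = q , there q∈

coeff-nonNegative : ∀ x → All (λ p → proj₁ p ≡ 1ℚ) x → ∀ Φ → 0ℚ ℚ.≤ coeff x Φ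
coeff-nonNegative [] [] Φ = ℚ.≤-refl
coeff-nonNegative (p ∷ x) (p≡1 ∷ ones) Φ = step (proj₂ p ≟SC Φ)
  where
  step : Dec (proj₂ p ≡ Φ) → 0ℚ ℚ.≤ coeff (p ∷ x) Φ
  step (yes eq) = subst (0ℚ ℚ.≤_) (sym (coeff-∷-≡ p x Φ eq))
    (subst₂ ℚ._≤_ (ℚ.+-identityˡ 0ℚ) (cong (ℚ._+ coeff x Φ) (sym p≡1))
      (ℚ.+-mono-≤ (toWitness {a? = 0ℚ ℚ.≤? 1ℚ} tt) (coeff-nonNegative x ones Φ)))
  step (no neq) = subst (0ℚ ℚ.≤_) (sym (coeff-∷-≢ p x Φ neq)) (coeff-nonNegative x ones Φ)

coeff-positive : ∀ x → All (λ p → proj₁ p ≡ 1ℚ) x → ∀ {q Φ} → (q , Φ) ∈ x → 0ℚ ℚ.< coeff x Φ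
coeff-positive (p ∷ x) (p≡1 ∷ ones) {q} {Φ} = step (proj₂ p ≟SC Φ)
  where
  step : Dec (proj₂ p ≡ Φ) → (q , Φ) ∈ p ∷ x → 0ℚ ℚ.< coeff (p ∷ x) Φ
  step (yes eq) _ = subst (0ℚ ℚ.<_) (sym (coeff-∷-≡ p x Φ eq))
    (subst₂ ℚ._<_ (ℚ.+-identityˡ 0ℚ) (cong (ℚ._+ coeff x Φ) (sym p≡1))
      (ℚ.+-mono-<-≤ (toWitness {a? = 0ℚ ℚ.<? 1ℚ} tt) (coeff-nonNegative x ones Φ)))
  step (no neq) (here refl) = ⊥-elim (neq refl)
  step (no neq) (there q∈) = subst (0ℚ ℚ.<_) (sym (coeff-∷-≢ p x Φ neq)) (coeff-positive x ones q∈)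

coeff-prodV-bars : ∀ {w} → All Atomic w → coeff (prodV w) (bars w) ≢ 0ℚ
coeff-prodV-bars ats ≡0 = ℚ.<-irrefl (sym ≡0)
  (coeff-positive _ (All.tabulate (proj₁ ∘ prodV-term ats)) (bars∈prodV ats))

Words : List (ℚ × List SC) → Set
Words c = All (λ p → Word (proj₂ p)) c

record Spanned (x : Lin) : Set where
  constructor span
  field
    combination : List (ℚ × List SC)
    words : Words combination
    ≈comb : x ≈ comb combination

scaleTerm : ℚ → ℚ × List SC → ℚ × List SC
scaleTerm a p = a ℚ.* proj₁ p , proj₂ p

coeff-comb-scale : ∀ a c Φ → coeff (comb (map (scaleTerm a) c)) Φ ≡ a ℚ.* coeff (comb c) Φ
coeff-comb-scale a [] Φ = sym (ℚ.*-zeroʳ a)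
coeff-comb-scale a ((b , w) ∷ c) Φ = begin
  coeff (scale (a ℚ.* b) (prodV w) ++ comb (map (scaleTerm a) c)) Φ
    ≡⟨ coeff-++ (scale (a ℚ.* b) (prodV w)) _ Φ ⟩
  coeff (scale (a ℚ.* b) (prodV w)) Φ ℚ.+ coeff (comb (map (scaleTerm a) c)) Φ
    ≡⟨ cong₂ ℚ._+_ (trans (coeff-scale (a ℚ.* b) (prodV w) Φ) (ℚ.*-assoc a b _)) (coeff-comb-scale a c Φ) ⟩
  a ℚ.* (b ℚ.* coeff (prodV w) Φ) ℚ.+ a ℚ.* coeff (comb c) Φ
    ≡⟨ sym (ℚ.*-distribˡ-+ a _ _) ⟩
  a ℚ.* (b ℚ.* coeff (prodV w) Φ ℚ.+ coeff (comb c) Φ)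
    ≡⟨ cong (a ℚ.*_) (sym (trans (coeff-++ (scale b (prodV w)) (comb c) Φ) (cong (ℚ._+ _) (coeff-scale b (prodV w) Φ)))) ⟩
  a ℚ.* coeff (comb ((b , w) ∷ c)) Φ ∎
  where open ≡-Reasoning

Spanned-resp-≈ : ∀ {x y} → x ≈ y → Spanned x → Spanned y
Spanned-resp-≈ x≈y (span c words x≈c) = span c words λ Φ → trans (sym (x≈y Φ)) (x≈c Φ)

Spanned-[] : Spanned []
Spanned-[] = span [] [] λ _ → refl

Spanned-++ : ∀ {x y} → Spanned x → Spanned y → Spanned (x ++ y)
Spanned-++ {x} {y} (span c wc x≈c) (span d wd y≈d) = span (c ++ d) (All.++⁺ wc wd) λ Φ → begin
  coeff (x ++ y) Φ                    ≡⟨ coeff-++ x y Φ ⟩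
  coeff x Φ ℚ.+ coeff y Φ             ≡⟨ cong₂ ℚ._+_ (x≈c Φ) (y≈d Φ) ⟩
  coeff (comb c) Φ ℚ.+ coeff (comb d) Φ ≡⟨ sym (coeff-++ (comb c) (comb d) Φ) ⟩
  coeff (comb c ++ comb d) Φ          ≡⟨ cong (λ z → coeff z Φ) (sym (List.concatMap-++ _ c d)) ⟩
  coeff (comb (c ++ d)) Φ             ∎
  where open ≡-Reasoning

Spanned-scale : ∀ a {x} → Spanned x → Spanned (scale a x)
Spanned-scale a {x} (span c wc x≈c) = span (map (scaleTerm a) c) (All.map⁺ wc)
  λ Φ → trans (coeff-scale a x Φ) (trans (cong (a ℚ.*_) (x≈c Φ)) (sym (coeff-comb-scale a c Φ)))

Spanned-prodV : ∀ {u} → Word u → Spanned (prodV u)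
Spanned-prodV {u} wu = span ((1ℚ , u) ∷ []) (wu ∷ []) λ Φ → sym (begin
  coeff (scale 1ℚ (prodV u) ++ []) Φ        ≡⟨ coeff-++ (scale 1ℚ (prodV u)) [] Φ ⟩
  coeff (scale 1ℚ (prodV u)) Φ ℚ.+ 0ℚ      ≡⟨ ℚ.+-identityʳ _ ⟩
  coeff (scale 1ℚ (prodV u)) Φ             ≡⟨ coeff-scale 1ℚ (prodV u) Φ ⟩
  1ℚ ℚ.* coeff (prodV u) Φ                 ≡⟨ ℚ.*-identityˡ _ ⟩
  coeff (prodV u) Φ                        ∎)
  where open ≡-Reasoning

Spanned-terms : ∀ {x} → All (λ p → Spanned (W (proj₂ p))) x → Spanned x
Spanned-terms [] = Spanned-[]
Spanned-terms {p ∷ x} (Wp ∷ Wx) =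
  Spanned-resp-≈ (λ Φ → sym (coeff-∷ p x Φ)) (Spanned-++ (Spanned-scale (proj₁ p) Wp) (Spanned-terms Wx))

others : SC → Lin → Lin
others Ψ = filter (λ p → ¬? (proj₂ p ≟SC Ψ))

coeff-others-≡ : ∀ Ψ x → coeff (others Ψ x) Ψ ≡ 0ℚ
coeff-others-≡ Ψ [] = refl
coeff-others-≡ Ψ (p ∷ x) = step (proj₂ p ≟SC Ψ)
  where
  step : Dec (proj₂ p ≡ Ψ) → coeff (others Ψ (p ∷ x)) Ψ ≡ 0ℚ
  step (yes eq) = trans (cong (λ z → coeff z Ψ) (List.filter-reject (λ q → ¬? (proj₂ q ≟SC Ψ)) (λ neq → neq eq)))
    (coeff-others-≡ Ψ x)
  step (no neq) = trans (cong (λ z → coeff z Ψ) (List.filter-accept (λ q → ¬? (proj₂ q ≟SC Ψ)) neq))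
    (trans (coeff-∷-≢ p (others Ψ x) Ψ neq) (coeff-others-≡ Ψ x))

coeff-others-≢ : ∀ Ψ x {Φ} → Φ ≢ Ψ → coeff (others Ψ x) Φ ≡ coeff x Φ
coeff-others-≢ Ψ [] _ = refl
coeff-others-≢ Ψ (p ∷ x) {Φ} Φ≢Ψ = step (proj₂ p ≟SC Ψ)
  where
  step : Dec (proj₂ p ≡ Ψ) → coeff (others Ψ (p ∷ x)) Φ ≡ coeff (p ∷ x) Φ
  step (yes eq) = trans (cong (λ z → coeff z Φ) (List.filter-reject (λ q → ¬? (proj₂ q ≟SC Ψ)) (λ neq → neq eq)))
    (trans (coeff-others-≢ Ψ x Φ≢Ψ) (sym (coeff-∷-≢ p x Φ (λ p≡Φ → Φ≢Ψ (trans (sym p≡Φ) eq)))))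
  step (no neq) = trans (cong (λ z → coeff z Φ) (List.filter-accept (λ q → ¬? (proj₂ q ≟SC Ψ)) neq))
    (trans (coeff-++ ((p ∷ [])) (others Ψ x) Φ)
      (trans (cong (coeff (p ∷ []) Φ ℚ.+_) (coeff-others-≢ Ψ x Φ≢Ψ)) (sym (coeff-++ (p ∷ []) x Φ))))

-- Solving x = coeff x Ψ · W_Ψ + others Ψ x for W_Ψ.
W-isolate : ∀ x Ψ (nz : coeff x Ψ ≢ 0ℚ) →
  W Ψ ≈ scale (ℚ.1/_ (coeff x Ψ) {{ℚ.≢-nonZero nz}}) (x ++ scale (ℚ.- 1ℚ) (others Ψ x))
W-isolate x Ψ nz Φ = sym (trans rhs (step (Φ ≟SC Ψ)))
  where
  g = coeff x Ψ
  instance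
    g-nonZero : ℚ.NonZero g
    g-nonZero = ℚ.≢-nonZero nz
  open ≡-Reasoning
  -1*p≡-p : ∀ a → ℚ.- 1ℚ ℚ.* a ≡ ℚ.- a
  -1*p≡-p a = trans (sym (ℚ.neg-distribˡ-* 1ℚ a)) (cong ℚ.-_ (ℚ.*-identityˡ a))
  rhs : coeff (scale (ℚ.1/ g) (x ++ scale (ℚ.- 1ℚ) (others Ψ x))) Φ ≡ ℚ.1/ g ℚ.* (coeff x Φ ℚ.- coeff (others Ψ x) Φ)
  rhs = begin
    coeff (scale (ℚ.1/ g) (x ++ scale (ℚ.- 1ℚ) (others Ψ x))) Φ
      ≡⟨ coeff-scale (ℚ.1/ g) (x ++ scale (ℚ.- 1ℚ) (others Ψ x)) Φ ⟩
    ℚ.1/ g ℚ.* coeff (x ++ scale (ℚ.- 1ℚ) (others Ψ x)) Φ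
      ≡⟨ cong (ℚ.1/ g ℚ.*_) (coeff-++ x (scale (ℚ.- 1ℚ) (others Ψ x)) Φ) ⟩
    ℚ.1/ g ℚ.* (coeff x Φ ℚ.+ coeff (scale (ℚ.- 1ℚ) (others Ψ x)) Φ)
      ≡⟨ cong (λ c → ℚ.1/ g ℚ.* (coeff x Φ ℚ.+ c)) (trans (coeff-scale (ℚ.- 1ℚ) (others Ψ x) Φ) (-1*p≡-p _)) ⟩
    ℚ.1/ g ℚ.* (coeff x Φ ℚ.- coeff (others Ψ x) Φ) ∎
  step : Dec (Φ ≡ Ψ) → ℚ.1/ g ℚ.* (coeff x Φ ℚ.- coeff (others Ψ x) Φ) ≡ coeff (W Ψ) Φ
  step (yes refl) = begin
    ℚ.1/ g ℚ.* (g ℚ.- coeff (others Ψ x) Ψ)   ≡⟨ cong (λ c → ℚ.1/ g ℚ.* (g ℚ.- c)) (coeff-others-≡ Ψ x) ⟩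
    ℚ.1/ g ℚ.* (g ℚ.- 0ℚ)                      ≡⟨ cong (ℚ.1/ g ℚ.*_) (ℚ.+-identityʳ g) ⟩
    ℚ.1/ g ℚ.* g                               ≡⟨ ℚ.*-inverseˡ g ⟩
    1ℚ                                         ≡⟨ sym (coeff-W-≡ Ψ) ⟩
    coeff (W Ψ) Ψ                              ∎
  step (no Φ≢Ψ) = begin
    ℚ.1/ g ℚ.* (coeff x Φ ℚ.- coeff (others Ψ x) Φ) ≡⟨ cong (λ c → ℚ.1/ g ℚ.* (coeff x Φ ℚ.- c)) (coeff-others-≢ Ψ x Φ≢Ψ) ⟩
    ℚ.1/ g ℚ.* (coeff x Φ ℚ.- coeff x Φ)           ≡⟨ cong (ℚ.1/ g ℚ.*_) (ℚ.+-inverseʳ (coeff x Φ)) ⟩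
    ℚ.1/ g ℚ.* 0ℚ                                   ≡⟨ ℚ.*-zeroʳ (ℚ.1/ g) ⟩
    0ℚ                                              ≡⟨ sym (coeff-W-≢ (Φ≢Ψ ∘ sym)) ⟩
    coeff (W Ψ) Φ                                   ∎

Spanned-isolate : ∀ x Ψ → coeff x Ψ ≢ 0ℚ → Spanned x → Spanned (others Ψ x) → Spanned (W Ψ)
Spanned-isolate x Ψ nz sx so =
  Spanned-resp-≈ (λ Φ → sym (W-isolate x Ψ nz Φ))
    (Spanned-scale (ℚ.1/_ (coeff x Ψ) {{ℚ.≢-nonZero nz}}) (Spanned-++ sx (Spanned-scale (ℚ.- 1ℚ) so)))

cutCount-< : ∀ {n u Ψ} → All Atomic u → Chunks u Ψ → IsSetComp n Ψ → Ψ ≢ bars u → cutCount Ψ < length u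
cutCount-< ats ch sc Ψ≢ with ℕ.m≤n⇒m<n∨m≡n (cutCount-≤ ats ch)
... | inj₁ count< = count<
... | inj₂ count≡ = ⊥-elim (Ψ≢ (cutCount-≡⇒bars ats ch sc count≡))

-- Induction on the number of cuts: W_Ψ is V_u up to scaling, minus terms with fewer cuts.
W-spanned : ∀ r {n Ψ} → IsSetComp n Ψ → cutCount Ψ < r → Spanned (W Ψ)
W-spanned (suc r) {n} {Ψ} sc count< with atomic-factorization (length Ψ) ℕ.≤-refl sc
... | u , ats , refl = Spanned-isolate (prodV u) (bars u) (coeff-prodV-bars ats) (Spanned-prodV ats)
  (Spanned-terms (All.tabulate smaller))
  where
  smaller : ∀ {p} → p ∈ others (bars u) (prodV u) → Spanned (W (proj₂ p))
  smaller p∈ with ∈.∈-filter⁻ (λ q → ¬? (proj₂ q ≟SC bars u)) {xs = prodV u} p∈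
  ... | p∈prodV , p≢ with prodV-term ats p∈prodV
  ...   | _ , sc′ , ch′ = W-spanned r sc′
    (ℕ.≤-trans (subst (_ <_) (sym (cutCount-bars ats)) (cutCount-< ats ch′ sc′ p≢)) (ℕ.≤-pred count<))

spanned : ∀ x → All (λ p → Σ ℕ λ n → IsSetComp n (proj₂ p)) x → Spanned x
spanned x setComps = Spanned-terms (All.map W-spanned′ setComps)
  where
  W-spanned′ : ∀ {Ψ : SC} → (Σ ℕ λ n → IsSetComp n Ψ) → Spanned (W Ψ)
  W-spanned′ {Ψ} (n , sc) = W-spanned (suc (cutCount Ψ)) sc ℕ.≤-refl

-- Linear independence

_≟W_ : (u v : List SC) → Dec (u ≡ v)
_≟W_ = List.≡-dec _≟SC_

weightedSum : List (ℚ × List SC) → (List SC → ℚ) → ℚ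
weightedSum [] g = 0ℚ
weightedSum (p ∷ c) g = proj₁ p ℚ.* g (proj₂ p) ℚ.+ weightedSum c g

coeff-comb : ∀ c Φ → coeff (comb c) Φ ≡ weightedSum c (λ w → coeff (prodV w) Φ)
coeff-comb [] Φ = refl
coeff-comb (p ∷ c) Φ = trans (coeff-++ (scale (proj₁ p) (prodV (proj₂ p))) (comb c) Φ)
  (cong₂ ℚ._+_ (coeff-scale (proj₁ p) (prodV (proj₂ p)) Φ) (coeff-comb c Φ))

wcoeff-∷-≡ : ∀ p c u → proj₂ p ≡ u → wcoeff (p ∷ c) u ≡ proj₁ p ℚ.+ wcoeff c u
wcoeff-∷-≡ p c u eq = cong (foldr ℚ._+_ 0ℚ ∘ map proj₁) (List.filter-accept (λ q → proj₂ q ≟W u) eq)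

wcoeff-∷-≢ : ∀ p c u → proj₂ p ≢ u → wcoeff (p ∷ c) u ≡ wcoeff c u
wcoeff-∷-≢ p c u neq = cong (foldr ℚ._+_ 0ℚ ∘ map proj₁) (List.filter-reject (λ q → proj₂ q ≟W u) neq)

wcoeff-absent : ∀ c u → ¬ Any (λ p → proj₂ p ≡ u) c → wcoeff c u ≡ 0ℚ
wcoeff-absent [] u _ = refl
wcoeff-absent (p ∷ c) u absent = trans (wcoeff-∷-≢ p c u (absent ∘ here)) (wcoeff-absent c u (absent ∘ there))

withoutWord : List SC → List (ℚ × List SC) → List (ℚ × List SC)
withoutWord u = filter (λ p → ¬? (proj₂ p ≟W u))

withoutWord-∷-≡ : ∀ p c u → proj₂ p ≡ u → withoutWord u (p ∷ c) ≡ withoutWord u c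
withoutWord-∷-≡ p c u eq = List.filter-reject (λ q → ¬? (proj₂ q ≟W u)) (λ neq → neq eq)

withoutWord-∷-≢ : ∀ p c u → proj₂ p ≢ u → withoutWord u (p ∷ c) ≡ p ∷ withoutWord u c
withoutWord-∷-≢ p c u neq = List.filter-accept (λ q → ¬? (proj₂ q ≟W u)) neq

weightedSum-split : ∀ c g u → weightedSum c g ≡ wcoeff c u ℚ.* g u ℚ.+ weightedSum (withoutWord u c) g
weightedSum-split [] g u = sym (trans (ℚ.+-identityʳ (0ℚ ℚ.* g u)) (ℚ.*-zeroˡ (g u)))
weightedSum-split (p ∷ c) g u = step (proj₂ p ≟W u)
  where
  open ≡-Reasoning
  a = proj₁ p
  rest = weightedSum (withoutWord u c) g
  step : Dec (proj₂ p ≡ u) → weightedSum (p ∷ c) g ≡ wcoeff (p ∷ c) u ℚ.* g u ℚ.+ weightedSum (withoutWord u (p ∷ c)) g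
  step (yes refl) = begin
    a ℚ.* g u ℚ.+ weightedSum c g                          ≡⟨ cong (a ℚ.* g u ℚ.+_) (weightedSum-split c g u) ⟩
    a ℚ.* g u ℚ.+ (wcoeff c u ℚ.* g u ℚ.+ rest)            ≡⟨ sym (ℚ.+-assoc (a ℚ.* g u) _ rest) ⟩
    (a ℚ.* g u ℚ.+ wcoeff c u ℚ.* g u) ℚ.+ rest            ≡⟨ cong (ℚ._+ rest) (sym (ℚ.*-distribʳ-+ (g u) a (wcoeff c u))) ⟩
    (a ℚ.+ wcoeff c u) ℚ.* g u ℚ.+ rest                    ≡⟨ cong₂ (λ w z → w ℚ.* g u ℚ.+ weightedSum z g)
                                                               (sym (wcoeff-∷-≡ p c u refl)) (sym (withoutWord-∷-≡ p c u refl)) ⟩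
    wcoeff (p ∷ c) u ℚ.* g u ℚ.+ weightedSum (withoutWord u (p ∷ c)) g ∎
  step (no neq) = begin
    a ℚ.* g (proj₂ p) ℚ.+ weightedSum c g                  ≡⟨ cong (a ℚ.* g (proj₂ p) ℚ.+_) (weightedSum-split c g u) ⟩
    a ℚ.* g (proj₂ p) ℚ.+ (wcoeff c u ℚ.* g u ℚ.+ rest)    ≡⟨ sym (ℚ.+-assoc (a ℚ.* g (proj₂ p)) (wcoeff c u ℚ.* g u) rest) ⟩
    (a ℚ.* g (proj₂ p) ℚ.+ wcoeff c u ℚ.* g u) ℚ.+ rest    ≡⟨ cong (ℚ._+ rest) (ℚ.+-comm (a ℚ.* g (proj₂ p)) (wcoeff c u ℚ.* g u)) ⟩
    (wcoeff c u ℚ.* g u ℚ.+ a ℚ.* g (proj₂ p)) ℚ.+ rest    ≡⟨ ℚ.+-assoc (wcoeff c u ℚ.* g u) (a ℚ.* g (proj₂ p)) rest ⟩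
    wcoeff c u ℚ.* g u ℚ.+ (a ℚ.* g (proj₂ p) ℚ.+ rest)    ≡⟨ cong₂ (λ w z → w ℚ.* g u ℚ.+ weightedSum z g)
                                                               (sym (wcoeff-∷-≢ p c u neq)) (sym (withoutWord-∷-≢ p c u neq)) ⟩
    wcoeff (p ∷ c) u ℚ.* g u ℚ.+ weightedSum (withoutWord u (p ∷ c)) g ∎

wcoeff-withoutWord : ∀ c u v → v ≢ u → wcoeff (withoutWord u c) v ≡ wcoeff c v
wcoeff-withoutWord [] u v _ = refl
wcoeff-withoutWord (p ∷ c) u v v≢u = step (proj₂ p ≟W u) (proj₂ p ≟W v)
  where
  step : Dec (proj₂ p ≡ u) → Dec (proj₂ p ≡ v) → wcoeff (withoutWord u (p ∷ c)) v ≡ wcoeff (p ∷ c) v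
  step (yes p≡u) _ = trans (cong (λ z → wcoeff z v) (withoutWord-∷-≡ p c u p≡u))
    (trans (wcoeff-withoutWord c u v v≢u) (sym (wcoeff-∷-≢ p c v λ p≡v → v≢u (trans (sym p≡v) p≡u))))
  step (no p≢u) (yes p≡v) = trans (cong (λ z → wcoeff z v) (withoutWord-∷-≢ p c u p≢u))
    (trans (wcoeff-∷-≡ p (withoutWord u c) v p≡v)
      (trans (cong (proj₁ p ℚ.+_) (wcoeff-withoutWord c u v v≢u)) (sym (wcoeff-∷-≡ p c v p≡v))))
  step (no p≢u) (no p≢v) = trans (cong (λ z → wcoeff z v) (withoutWord-∷-≢ p c u p≢u))
    (trans (wcoeff-∷-≢ p (withoutWord u c) v p≢v) (trans (wcoeff-withoutWord c u v v≢u) (sym (wcoeff-∷-≢ p c v p≢v))))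

-- Terms sharing a word may cancel, so each step splits off all terms of one word.
weightedSum-vanishes : ∀ r c g → length c ≤ r → (∀ {p} → p ∈ c → wcoeff c (proj₂ p) ≡ 0ℚ ⊎ g (proj₂ p) ≡ 0ℚ) →
  weightedSum c g ≡ 0ℚ
weightedSum-vanishes r [] g _ _ = refl
weightedSum-vanishes (suc r) (p ∷ c) g (s≤s len≤) zero-or = begin
  weightedSum (p ∷ c) g                                          ≡⟨ weightedSum-split (p ∷ c) g u ⟩
  wcoeff (p ∷ c) u ℚ.* g u ℚ.+ weightedSum (withoutWord u (p ∷ c)) g ≡⟨ cong₂ ℚ._+_ first (trans (cong (λ z → weightedSum z g) (withoutWord-∷-≡ p c u refl)) rest) ⟩
  0ℚ ℚ.+ 0ℚ                                                      ≡⟨ ℚ.+-identityʳ 0ℚ ⟩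
  0ℚ                                                             ∎
  where
  open ≡-Reasoning
  u = proj₂ p
  first : wcoeff (p ∷ c) u ℚ.* g u ≡ 0ℚ
  first with zero-or (here refl)
  ... | inj₁ w≡0 = trans (cong (ℚ._* g u) w≡0) (ℚ.*-zeroˡ (g u))
  ... | inj₂ g≡0 = trans (cong (wcoeff (p ∷ c) u ℚ.*_) g≡0) (ℚ.*-zeroʳ (wcoeff (p ∷ c) u))
  zero-or′ : ∀ {q} → q ∈ withoutWord u c → wcoeff (withoutWord u c) (proj₂ q) ≡ 0ℚ ⊎ g (proj₂ q) ≡ 0ℚ
  zero-or′ {q} q∈ with ∈.∈-filter⁻ (λ q → ¬? (proj₂ q ≟W u)) {xs = c} q∈
  ... | q∈c , q≢u with zero-or (there q∈c)
  ...   | inj₂ g≡0 = inj₂ g≡0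
  ...   | inj₁ w≡0 = inj₁ (trans (cong (λ z → wcoeff z (proj₂ q)) (sym (withoutWord-∷-≡ p c u refl)))
                           (trans (wcoeff-withoutWord (p ∷ c) u (proj₂ q) q≢u) w≡0))
  rest : weightedSum (withoutWord u c) g ≡ 0ℚ
  rest = weightedSum-vanishes r (withoutWord u c) g
    (ℕ.≤-trans (List.length-filter (λ q → ¬? (proj₂ q ≟W u)) c) len≤) zero-or′

p*q≡0⇒p≡0 : ∀ p q → p ℚ.* q ≡ 0ℚ → q ≢ 0ℚ → p ≡ 0ℚ
p*q≡0⇒p≡0 p q pq≡0 q≢0 = begin
  p                            ≡⟨ sym (ℚ.*-identityʳ p) ⟩
  p ℚ.* 1ℚ                     ≡⟨ cong (p ℚ.*_) (sym (ℚ.*-inverseʳ q)) ⟩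
  p ℚ.* (q ℚ.* ℚ.1/ q)         ≡⟨ sym (ℚ.*-assoc p q _) ⟩
  (p ℚ.* q) ℚ.* ℚ.1/ q         ≡⟨ cong (ℚ._* ℚ.1/ q) pq≡0 ⟩
  0ℚ ℚ.* ℚ.1/ q                ≡⟨ ℚ.*-zeroˡ (ℚ.1/ q) ⟩
  0ℚ                           ∎
  where
  open ≡-Reasoning
  instance
    q-nonZero : ℚ.NonZero q
    q-nonZero = ℚ.≢-nonZero q≢0

excess : List SC → ℕ
excess u = totalLength u ∸ length u

length≤totalLength : ∀ {v} → All Atomic v → length v ≤ totalLength v
length≤totalLength [] = z≤n
length≤totalLength (at ∷ ats) = ℕ.+-mono-≤ (atomic-length at) (length≤totalLength ats)

-- bars u has as many cuts as u has letters, and a term of V_v has at most as many cuts as v has letters.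
excess-decreases : ∀ {u v} → Word u → Word v → u ≢ v → coeff (prodV v) (bars u) ≢ 0ℚ → excess v < excess u
excess-decreases {u} {v} wu wv u≢v nz with coeff-≢0⇒∈ (prodV v) (bars u) nz
... | _ , term∈ with prodV-term wv term∈
...   | _ , sc , ch = subst (λ t → t ∸ length v < totalLength u ∸ length u) (sym total≡) (ℕ.∸-monoʳ-< shorter
        (subst (length v ≤_) total≡ (length≤totalLength wv)))
  where
  total≡ : totalLength v ≡ totalLength u
  total≡ = trans (sym (Chunks-length ch)) (Chunks-length (bars-Chunks wu))
  shorter : length u < length v
  shorter = subst (_< length v) (cutCount-bars wu) (cutCount-< wv ch sc λ bars≡ → u≢v (bars-injective wu wv bars≡))

-- Induction on the excess: at W_{bars u} only u and words of smaller excess contribute.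
module Independence (c : List (ℚ × List SC)) (words : Words c) (comb≈0 : comb c ≈ zeroL) where

  wcoeff-vanishes-below : ∀ d u → Word u → excess u < d → wcoeff c u ≡ 0ℚ
  wcoeff-vanishes-below (suc d) u wu excess< = p*q≡0⇒p≡0 (wcoeff c u) (g u) weighted≡0 (coeff-prodV-bars wu)
    where
    g : List SC → ℚ
    g v = coeff (prodV v) (bars u)
    zero-or : ∀ {p} → p ∈ withoutWord u c → wcoeff (withoutWord u c) (proj₂ p) ≡ 0ℚ ⊎ g (proj₂ p) ≡ 0ℚ
    zero-or {p} p∈ with ∈.∈-filter⁻ (λ q → ¬? (proj₂ q ≟W u)) {xs = c} p∈
    ... | p∈c , p≢u with g (proj₂ p) ℚ.≟ 0ℚ
    ...   | yes g≡0 = inj₂ g≡0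
    ...   | no g≢0 = inj₁ (trans (wcoeff-withoutWord c u (proj₂ p) p≢u)
      (wcoeff-vanishes-below d (proj₂ p) wv (ℕ.<-≤-trans (excess-decreases wu wv (p≢u ∘ sym) g≢0) (ℕ.≤-pred excess<))))
      where
      wv = All.lookup words p∈c
    weighted≡0 : wcoeff c u ℚ.* g u ≡ 0ℚ
    weighted≡0 = begin
      wcoeff c u ℚ.* g u                                      ≡⟨ sym (ℚ.+-identityʳ _) ⟩
      wcoeff c u ℚ.* g u ℚ.+ 0ℚ                               ≡⟨ cong (wcoeff c u ℚ.* g u ℚ.+_)
                                                                   (sym (weightedSum-vanishes (length c) (withoutWord u c) g
                                                                     (List.length-filter (λ q → ¬? (proj₂ q ≟W u)) c) zero-or)) ⟩
      wcoeff c u ℚ.* g u ℚ.+ weightedSum (withoutWord u c) g  ≡⟨ sym (weightedSum-split c g u) ⟩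
      weightedSum c g                                         ≡⟨ sym (coeff-comb c (bars u)) ⟩
      coeff (comb c) (bars u)                                 ≡⟨ comb≈0 (bars u) ⟩
      0ℚ                                                      ∎
      where open ≡-Reasoning

  wcoeff-vanishes : ∀ u → wcoeff c u ≡ 0ℚ
  wcoeff-vanishes u with any? (λ p → proj₂ p ≟W u) c
  ... | no absent = wcoeff-absent c u absent
  ... | yes present with find present
  ...   | p , p∈ , refl = wcoeff-vanishes-below (suc (excess (proj₂ p))) (proj₂ p) (All.lookup words p∈) ℕ.≤-refl

mainTheorem15 :
  -- the products V_{Φ₁}⋯V_{Φₖ} (Φᵢ atomic) span NCQSym*
  ((x : Lin) → All (λ p → Σ ℕ λ n → IsSetComp n (proj₂ p)) x →
    Σ (List (ℚ × List SC)) λ c → All (λ p → Word (proj₂ p)) c × (x ≈ comb c))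
  ×
  -- and are linearly independent (the map from the free algebra is injective)
  ((c : List (ℚ × List SC)) → All (λ p → Word (proj₂ p)) c → comb c ≈ zeroL →
    (u : List SC) → wcoeff c u ≡ 0ℚ)
mainTheorem15 = (λ x setComps → let open Spanned (spanned x setComps) in combination , words , ≈comb)
  , λ c words comb≈0 → Independence.wcoeff-vanishes c words comb≈0
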